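{- Let $W$ be a wing with point of return $k$ and companion vertex $k'$, with $|w_{kk'}|=1$. Then for every vertex $r\neq k,k'$, $\mu_r(W)$ is a fork with point of return $r$. Moreover, $Q=\mu_{k'}(W)$ satisfies: (1) $Q\setminus\{k\}$ is a fork with point of return $k'$; (2) $Q^k_{k'}=Q^-(k')\neq\emptyset$ if $q_{k'k}=w_{kk'}=1$, and $Q^k_{k'}=Q^+(k')\neq\emptyset$ if $q_{kk'}=w_{k'k}=1$; (3) $Q\setminus\{k'\}$ is abundant acyclic, and $k$ is a source of $Q\setminus\{k'\}$ if $q_{k'k}=1$ and a sink of $Q\setminus\{k'\}$ if $q_{kk'}=1$; (4) $|Q_1|>|W_1|$; (5) for $r\in Q^k_{k'}$, $F=\mu_r(Q)$ is a fork with point of return $r$, and for $r\notin Q^k_{k'}\cup\{k,k'\}$, $F=\mu_r(Q)$ is a pre-fork with vertices $\{r,k,k'\}$; in either case $|F_1|>|Q_1|$; (6) whenever a vertex $i$ with $a,b>0$ gives in $Q$ either ($a$ arrows $k\to i$, $b$ arrows $i\to k'$, and an arrow $k'\to k$) or ($a$ arrows $i\to k$, $b$ arrows $k'\to i$, and an arrow $k\to k'$), then $b\geq a+2$.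
   Context: A quiver is a finite directed multigraph with vertex set $Q_0$ and arrow set $Q_1$, no loops and no 2-cycles; $|Q_1|$ is the total number of arrows; $q_{ij}$ is the number of arrows $i\to j$ if positive and minus the number of arrows $j\to i$ otherwise (likewise $w_{ij}$). Mutation $\mu_v$: $q'_{ab}=-q_{ab}$ if $v\in\{a,b\}$, else $q'_{ab}=q_{ab}+\max(q_{av},0)\max(q_{vb},0)-\max(q_{bv},0)\max(q_{va},0)$. $Q\setminus V$ is the full subquiver on vertices not in $V$. $Q^+(v)=\{j:q_{vj}>0\}$, $Q^-(v)=\{j:q_{jv}>0\}$, $Q^k_{k'}=(Q^+(k)\cap Q^-(k'))\cup(Q^+(k')\cap Q^-(k))$. Abundant: at least two arrows between every pair of distinct vertices; acyclic: no directed cycle; source (sink): only outgoing (incoming) arrows. A fork is an abundant, non-acyclic quiver $F$ with a vertex $r$ (point of return) such that for all $i\in F^-(r)$, $j\in F^+(r)$: $f_{ji}>f_{ir}$ and $f_{ji}>f_{rj}$, and the full subquivers on $F^-(r)$, $F^+(r)$ are acyclic. A pre-fork with vertices $\{r,k,k'\}$ is a quiver $P$ with $k\ne k'$ such that $P\setminus\{k\}$ and $P\setminus\{k'\}$ are forks with common point of return $r$, and for each vertex $i\notin\{k,k'\}$ either ($k\to i$ and $k'\to i$) or ($i\to k$ and $i\to k'$), with any number (possibly zero) of arrows between $k$ and $k'$. A wing with point of return $k$ and companion vertex $k'$ is a quiver $W$ with $|w_{kk'}|<2$, $W^k_{k'}=W_0\setminus\{k,k'\}$, $W\setminus\{k'\}$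 a fork with point of return $k$, $W\setminus\{k\}$ abundant acyclic, and such that whenever a vertex $i$ with $a,b>0$ gives either ($a$ arrows $k\to i$, $b$ arrows $i\to k'$, one arrow $k'\to k$) or ($a$ arrows $i\to k$, $b$ arrows $k'\to i$, one arrow $k\to k'$), then $b\ge a+2$. -}

module Defs where

open import Level using (0ℓ)
open import Data.Nat using (ℕ) renaming (_<_ to _<ℕ_)
open import Data.Integer using (ℤ; +_; -_; _+_; _-_; _*_; _<_; _≤_; _⊔_; ∣_∣)
open import Data.Fin using (Fin; _≟_)
open import Data.List using (List; map; allFin)
open import Data.Nat.ListAction using (sum)
open import Data.Bool using (if_then_else_; _∨_)
open import Data.Unit using (⊤)
open import Data.Product using (_×_; _,_; ∃)
open import Data.Sum using (_⊎_)
open import Relation.Nullary using (¬_; does)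
open import Relation.Binary.PropositionalEquality using (_≡_; _≢_)
open import Relation.Unary using (Pred; _∈_; _∉_; _≐_)

-- A quiver on n vertices (Fin n) is encoded by its matrix q:
-- q i j > 0 : there are q i j arrows i → j ; q i j < 0 : there are - q i j arrows j → i.
Mat : ℕ → Set
Mat n = Fin n → Fin n → ℤ

-- skew-symmetry (no loops, no 2-cycles is built into the encoding)
IsQuiver : ∀ {n} → Mat n → Set
IsQuiver q = ∀ i j → q i j ≡ - q j i

-- vertex sets; a pair (q , S) denotes the full subquiver of q on S
VSet : ℕ → Set₁
VSet n = Pred (Fin n) 0ℓ

AllV : ∀ {n} → VSet n
AllV = λ _ → ⊤

_∖_ : ∀ {n} → VSet n → Fin n → VSet n
(S ∖ v) i = i ∈ S × i ≢ v

numArrows : ∀ {n} → Mat n → ℕ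
numArrows {n} q = sum (map (λ i → sum (map (λ j → ∣ q i j ⊔ + 0 ∣) (allFin n))) (allFin n))

[_]⁺ : ℤ → ℤ
[ x ]⁺ = x ⊔ + 0

μ : ∀ {n} → Fin n → Mat n → Mat n
μ v q a b =
  if does (v ≟ a) ∨ does (v ≟ b)
  then - q a b
  else q a b + [ q a v ]⁺ * [ q v b ]⁺ - [ q b v ]⁺ * [ q v a ]⁺

Out : ∀ {n} → Mat n → VSet n → Fin n → VSet n
Out q S v j = j ∈ S × + 0 < q v j

In : ∀ {n} → Mat n → VSet n → Fin n → VSet n
In q S v j = j ∈ S × + 0 < q j v

Between : ∀ {n} → Mat n → Fin n → Fin n → VSet n
Between q k k' i = (+ 0 < q k i × + 0 < q i k') ⊎ (+ 0 < q k' i × + 0 < q i k)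

Abundant : ∀ {n} → Mat n → VSet n → Set
Abundant q S = ∀ i j → i ∈ S → j ∈ S → i ≢ j → + 2 ≤ q i j ⊎ + 2 ≤ q j i

data Walk {n} (q : Mat n) (S : VSet n) : Fin n → Fin n → Set where
  edge : ∀ {i j} → i ∈ S → j ∈ S → + 0 < q i j → Walk q S i j
  step : ∀ {i j l} → i ∈ S → + 0 < q i j → Walk q S j l → Walk q S i l

Acyclic : ∀ {n} → Mat n → VSet n → Set
Acyclic q S = ∀ i → ¬ Walk q S i i

Source : ∀ {n} → Mat n → VSet n → Fin n → Set
Source q S v = v ∈ S × (∀ j → j ∈ S → ¬ (+ 0 < q j v))

Sink : ∀ {n} → Mat n → VSet n → Fin n → Set
Sink q S v = v ∈ S × (∀ j → j ∈ S → ¬ (+ 0 < q v j))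

Fork : ∀ {n} → Mat n → VSet n → Fin n → Set
Fork q S r =
  r ∈ S × Abundant q S × ¬ Acyclic q S
  × (∀ i j → i ∈ In q S r → j ∈ Out q S r → q i r < q j i × q r j < q j i)
  × Acyclic q (In q S r) × Acyclic q (Out q S r)

PreFork : ∀ {n} → Mat n → Fin n → Fin n → Fin n → Set
PreFork p r k k' =
  k ≢ k' × Fork p (AllV ∖ k) r × Fork p (AllV ∖ k') r
  × (∀ i → i ≢ k → i ≢ k' →
       (+ 0 < p k i × + 0 < p k' i) ⊎ (+ 0 < p i k × + 0 < p i k'))

WingArrowCond : ∀ {n} → Mat n → Fin n → Fin n → Set
WingArrowCond w k k' =
  (∀ i → + 0 < w k i → + 0 < w i k' → w k' k ≡ + 1 → w k i + + 2 ≤ w i k')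
  × (∀ i → + 0 < w i k → + 0 < w k' i → w k k' ≡ + 1 → w i k + + 2 ≤ w k' i)

Wing : ∀ {n} → Mat n → Fin n → Fin n → Set
Wing w k k' =
  ∣ w k k' ∣ <ℕ 2
  × Between w k k' ≐ ((AllV ∖ k) ∖ k')
  × Fork w (AllV ∖ k') k
  × Abundant w (AllV ∖ k) × Acyclic w (AllV ∖ k)
  × WingArrowCond w k k'

-- Passing to the opposite quiver exchanges the two signs of w k k', so we may assume an arrow k → k'.
-- The wing condition W^k_{k'} = W₀ ∖ {k, k'} then puts every other vertex i on a path k → i → k'
-- or on a path k' → i → k.  All forks of the statement come from one criterion: μ_r(Q) is a fork with
-- point of return r if r is joined to every other vertex by at least two arrows, Q⁻(r) and Q⁺(r) are
-- abundant and acyclic, and for x ∈ Q⁻(r), y ∈ Q⁺(r) the entry q y x stays below q x r or q r y; under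
-- the same conditions no entry shrinks and those through r grow, so |Q₁| increases.  In μ_{k'}(W) the wing
-- inequality b ≥ a + 2 keeps k joined to the vertices of a path k' → i → k by two arrows, and the
-- growth of the entries between the two kinds of vertices pays for the entries q k i that shrink.
module Submission where

open import Defs
open import Data.Nat using (ℕ) renaming (_<_ to _<ℕ_)
open import Data.Integer using (ℤ; +_; ∣_∣)
open import Data.Fin using (Fin)
open import Data.Product using (_×_; ∃)
open import Relation.Binary.PropositionalEquality using (_≡_; _≢_)
open import Relation.Unary using (_∈_; _∉_; _≐_)
open import Relation.Unary using (_⊆_)

open import Data.Nat using (z≤n; s≤s) renaming (_≤_ to _≤ℕ_)
import Data.Nat as ℕ
import Data.Nat.Properties as ℕₚ
import Data.Nat.Tactic.RingSolver as ℕ-Solver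
open import Data.Nat.ListAction using () renaming (sum to sumList)
open import Data.Integer using (-[1+_]; -_; _+_; _-_; _*_; _<_; _≤_; _⊔_; +≤+; +<+; -<+; _<?_; _≤?_)
open import Data.Integer.Properties hiding (_≟_)
open import Data.Integer.Tactic.RingSolver using (solve-∀)
open import Data.Fin using (zero; suc; _≟_)
open import Data.Fin.Properties using (any?)
open import Data.List using (map; allFin; tabulate)
open import Data.List.Properties using (map-tabulate)
open import Data.Vec.Functional using (updateAt)
open import Data.Vec.Functional.Properties using (updateAt-updates; updateAt-minimal)
open import Algebra.Properties.CommutativeMonoid.Sum ℕₚ.+-0-commutativeMonoid
  using (sum; ∑-comm; ∑-distrib-+; sum-cong-≗)
open import Data.Bool using (true; false)
open import Data.Unit using (⊤; tt)
open import Data.Empty using (⊥; ⊥-elim)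
open import Data.Product using (Σ; _,_; proj₁; proj₂)
open import Data.Sum using (_⊎_; inj₁; inj₂; [_,_]′; swap)
open import Function using (_∘_; id; const)
open import Relation.Nullary using (¬_; Dec; yes; no)
open import Relation.Nullary.Decidable using (_×-dec_; ¬?)
open import Relation.Binary.PropositionalEquality
  using (refl; sym; trans; cong; cong₂; subst; subst₂; module ≡-Reasoning)

-- Integer arithmetic

0≤+ : ∀ {x y} → + 0 ≤ x → + 0 ≤ y → + 0 ≤ x + y
0≤+ = +-mono-≤

0≤* : ∀ {x y} → + 0 ≤ x → + 0 ≤ y → + 0 ≤ x * y
0≤* {+ a} {+ b} _ _ = subst (+ 0 ≤_) (pos-* a b) (+≤+ z≤n)

0≤+n : ∀ n → + 0 ≤ + n
0≤+n n = +≤+ z≤n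

0≤gap : ∀ {x y} → x ≤ y → + 0 ≤ y - x
0≤gap = i≤j⇒0≤j-i

0≤gap-1 : ∀ {x y} → x < y → + 0 ≤ y - x - + 1
0≤gap-1 {x} {y} x<y = subst (+ 0 ≤_) (regroup x y) (i≤j⇒0≤j-i (i<j⇒suc[i]≤j x<y))
  where
  regroup : ∀ x y → y - (+ 1 + x) ≡ y - x - + 1
  regroup = solve-∀

≤-by-gap : ∀ {x y} z → y ≡ x + z → + 0 ≤ z → x ≤ y
≤-by-gap {x} {y} z y≡x+z 0≤z =
  subst (_≤ y) (+-identityʳ x) (subst (x + + 0 ≤_) (sym y≡x+z) (+-monoʳ-≤ x 0≤z))

<-by-gap : ∀ {x y} z → y ≡ x + + 1 + z → + 0 ≤ z → x < y
<-by-gap {x} z y≡x+1+z 0≤z =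
  suc[i]≤j⇒i<j (≤-by-gap z (trans y≡x+1+z (cong (_+ z) (+-comm x (+ 1)))) 0≤z)

-1≢1 : -[1+ 0 ] ≢ + 1
-1≢1 ()

x<x+2 : ∀ x → x < x + + 2
x<x+2 x = <-by-gap (+ 1) (gap x) (0≤+n 1)
  where
  gap : ∀ x → x + + 2 ≡ x + + 1 + + 1
  gap = solve-∀

2≤⇒0< : ∀ {x} → + 2 ≤ x → + 0 < x
2≤⇒0< = <-≤-trans (+<+ (s≤s z≤n))

2≤⇒1≤ : ∀ {x} → + 2 ≤ x → + 1 ≤ x
2≤⇒1≤ = ≤-trans (+≤+ (s≤s z≤n))

2≤⇒1< : ∀ {x} → + 2 ≤ x → + 1 < x
2≤⇒1< = <-≤-trans (+<+ (s≤s (s≤s z≤n)))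

∣∣<∣∣ : ∀ x {y} → + ∣ x ∣ < y → + 0 ≤ y → ∣ x ∣ <ℕ ∣ y ∣
∣∣<∣∣ x ∣x∣<y 0≤y = drop‿+<+ (subst (_ <_) (sym (0≤i⇒+∣i∣≡i 0≤y)) ∣x∣<y)

∣x∣≤∣x+y∣ : ∀ {x y} → + 0 ≤ x → + 0 ≤ y → ∣ x ∣ ≤ℕ ∣ x + y ∣
∣x∣≤∣x+y∣ {+ m} {+ l} _ _ = ℕₚ.m≤m+n m l

2∣x∣+∣y∣<2∣x'∣+∣y'∣ : ∀ {x y x' y'} → + 0 ≤ x → + 0 ≤ y → + 0 ≤ x' → + 0 ≤ y' →
  x + x + y < x' + x' + y' → ∣ x ∣ ℕ.+ ∣ x ∣ ℕ.+ ∣ y ∣ <ℕ ∣ x' ∣ ℕ.+ ∣ x' ∣ ℕ.+ ∣ y' ∣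
2∣x∣+∣y∣<2∣x'∣+∣y'∣ {+ _} {+ _} {+ _} {+ _} _ _ _ _ lt = drop‿+<+ lt

nonpos<pos : ∀ {x y} → ¬ (+ 0 < x) → + 0 < y → x < y
nonpos<pos x≯0 = ≤-<-trans (≮⇒≥ x≯0)

[]⁺-pos : ∀ {x} → + 0 < x → [ x ]⁺ ≡ x
[]⁺-pos 0<x = i≥j⇒i⊔j≡i (<⇒≤ 0<x)

[]⁺-nonpos : ∀ {x} → ¬ (+ 0 < x) → [ x ]⁺ ≡ + 0
[]⁺-nonpos x≯0 = i≤j⇒i⊔j≡j (≮⇒≥ x≯0)

0≤[]⁺ : ∀ x → + 0 ≤ [ x ]⁺
0≤[]⁺ x = i≤j⊔i x (+ 0)

[]⁺*[]⁺≡0 : ∀ x y → (+ 0 < x → + 0 < y → ⊥) → [ x ]⁺ * [ y ]⁺ ≡ + 0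
[]⁺*[]⁺≡0 x y not-both with + 0 <? x | + 0 <? y
... | yes 0<x | yes 0<y = ⊥-elim (not-both 0<x 0<y)
... | no x≯0 | _ = trans (cong (_* [ y ]⁺) ([]⁺-nonpos x≯0)) (*-zeroˡ [ y ]⁺)
... | yes _ | no y≯0 = trans (cong ([ x ]⁺ *_) ([]⁺-nonpos y≯0)) (*-zeroʳ [ x ]⁺)

x≤x+[]⁺*[]⁺ : ∀ x y z → x ≤ x + [ y ]⁺ * [ z ]⁺
x≤x+[]⁺*[]⁺ x y z = ≤-by-gap _ refl (0≤* (0≤[]⁺ y) (0≤[]⁺ z))

module _ {a b : ℤ} (2≤a : + 2 ≤ a) (2≤b : + 2 ≤ b) where

  private
    A = 0≤gap 2≤a
    B = 0≤gap 2≤b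

  through-entry-dominates : ∀ {e} → e < a ⊎ e < b → b < - e + a * b × a < - e + a * b
  through-entry-dominates {e} (inj₁ e<a) =
    <-by-gap _ (gap₁ a b e) (0≤+ (0≤+ (0≤+ A B) (0≤gap-1 e<a)) (0≤* A B)) ,
    <-by-gap _ (gap₂ a b e) (0≤+ (0≤+ (0≤+ (0≤* A B) B) B) (0≤gap-1 e<a))
    where
    gap₁ : ∀ a b e → - e + a * b ≡ b + + 1 + ((a - + 2) + (b - + 2) + (a - e - + 1) + (a - + 2) * (b - + 2))
    gap₁ = solve-∀
    gap₂ : ∀ a b e → - e + a * b ≡ a + + 1 + ((a - + 2) * (b - + 2) + (b - + 2) + (b - + 2) + (a - e - + 1))
    gap₂ = solve-∀
  through-entry-dominates {e} (inj₂ e<b) =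
    <-by-gap _ (gap₁ a b e) (0≤+ (0≤+ (0≤+ (0≤* A B) A) A) (0≤gap-1 e<b)) ,
    <-by-gap _ (gap₂ a b e) (0≤+ (0≤+ (0≤+ A B) (0≤gap-1 e<b)) (0≤* A B))
    where
    gap₁ : ∀ a b e → - e + a * b ≡ b + + 1 + ((a - + 2) * (b - + 2) + (a - + 2) + (a - + 2) + (b - e - + 1))
    gap₁ = solve-∀
    gap₂ : ∀ a b e → - e + a * b ≡ a + + 1 + ((a - + 2) + (b - + 2) + (b - e - + 1) + (a - + 2) * (b - + 2))
    gap₂ = solve-∀

  ∣through-entry∣-grows : ∀ {e} → e < a ⊎ e < b → ∣ - e ∣ <ℕ ∣ - e + a * b ∣
  ∣through-entry∣-grows {e} e<a∨b with + 0 ≤? - e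
  ... | yes 0≤-e =
    ∣∣<∣∣ (- e) (subst (_< - e + a * b) (sym (0≤i⇒+∣i∣≡i 0≤-e)) -e<new) (≤-trans 0≤-e (<⇒≤ -e<new))
    where
    gap : ∀ a b d → d + a * b ≡ d + + 1 + ((a - + 2) * (b - + 2) + (a - + 2) + (a - + 2) + (b - + 2) + (b - + 2) + + 3)
    gap = solve-∀
    -e<new : - e < - e + a * b
    -e<new = <-by-gap _ (gap a b (- e)) (0≤+ (0≤+ (0≤+ (0≤+ (0≤+ (0≤* A B) A) A) B) B) (0≤+n 3))
  ... | no -e≱0 =
    ∣∣<∣∣ (- e) (subst (_< - e + a * b) (sym ∣-e∣≡e) (e<new e<a∨b)) (≤-trans 0≤e (<⇒≤ (e<new e<a∨b)))
    where
    0≤e : + 0 ≤ e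
    0≤e = subst (+ 0 ≤_) (neg-involutive e) (neg-mono-≤ (<⇒≤ (≰⇒> -e≱0)))
    ∣-e∣≡e : + ∣ - e ∣ ≡ e
    ∣-e∣≡e = trans (cong +_ (∣-i∣≡∣i∣ e)) (0≤i⇒+∣i∣≡i 0≤e)
    e<new : e < a ⊎ e < b → e < - e + a * b
    e<new (inj₁ e<a) = <-by-gap _ (gap a b e)
      (0≤+ (0≤+ (0≤+ (0≤+ (0≤+ (0≤* A B) B) B) (0≤gap-1 e<a)) (0≤gap-1 e<a)) (0≤+n 1))
      where
      gap : ∀ a b e → - e + a * b ≡
              e + + 1 + ((a - + 2) * (b - + 2) + (b - + 2) + (b - + 2) + (a - e - + 1) + (a - e - + 1) + + 1)
      gap = solve-∀
    e<new (inj₂ e<b) = <-by-gap _ (gap a b e)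
      (0≤+ (0≤+ (0≤+ (0≤+ (0≤+ (0≤* A B) A) A) (0≤gap-1 e<b)) (0≤gap-1 e<b)) (0≤+n 1))
      where
      gap : ∀ a b e → - e + a * b ≡
              e + + 1 + ((a - + 2) * (b - + 2) + (a - + 2) + (a - + 2) + (b - e - + 1) + (b - e - + 1) + + 1)
      gap = solve-∀

x<c+x*y : ∀ {c x y} → + 0 < c → + 0 ≤ x → + 1 ≤ y → x < c + x * y
x<c+x*y {c} {x} {y} 0<c 0≤x 1≤y = <-by-gap _ (gap c x y) (0≤+ (0≤gap-1 0<c) (0≤* 0≤x (0≤gap 1≤y)))
  where
  gap : ∀ c x y → c + x * y ≡ x + + 1 + ((c - + 0 - + 1) + x * (y - + 1))
  gap = solve-∀

0<-b+d[c+db] : ∀ {b c d} → + 1 ≤ b → + 0 ≤ c → + 2 ≤ d → + 0 < - b + d * (c + d * b)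
0<-b+d[c+db] {b} {c} {d} 1≤b 0≤c 2≤d = <-by-gap _ (gap b c d)
  (0≤+ (0≤+ (0≤+ (0≤+ (0≤* D 0≤c) (0≤* (0≤* D' D') 0≤b)) (0≤* (0≤+n 4) (0≤* D' 0≤b)))
            (0≤* (0≤+n 3) (0≤gap 1≤b)))
       (0≤+n 2))
  where
  D = ≤-trans (0≤+n 2) 2≤d
  D' = 0≤gap 2≤d
  0≤b = ≤-trans (0≤+n 1) 1≤b
  gap : ∀ b c d → - b + d * (c + d * b) ≡ + 0 + + 1 +
          (d * c + (d - + 2) * (d - + 2) * b + + 4 * ((d - + 2) * b) + + 3 * (b - + 1) + + 2)
  gap = solve-∀

2a+c<2[b-a]+c+db : ∀ {a b c d} → + 0 ≤ a → a < b → + 2 ≤ d → a + a + c < (b - a) + (b - a) + (c + d * b)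
2a+c<2[b-a]+c+db {a} {b} {c} {d} 0≤a a<b 2≤d = <-by-gap _ (gap a b c d)
  (0≤+ (0≤+ (0≤* (0≤+n 4) (0≤gap-1 a<b)) (0≤* (0≤gap 2≤d) (≤-trans 0≤a (<⇒≤ a<b)))) (0≤+n 3))
  where
  gap : ∀ a b c d → (b - a) + (b - a) + (c + d * b) ≡ a + a + c + + 1 + (+ 4 * (b - a - + 1) + (d - + 2) * b + + 3)
  gap = solve-∀

-- Quivers and mutation

module _ {n} {q : Mat n} (isQ : IsQuiver q) where

  quiver-diag : ∀ i → q i i ≡ + 0
  quiver-diag i with q i i | isQ i i
  ... | + 0 | _ = refl
  ... | + ℕ.suc m | ()
  ... | -[1+ m ] | ()

  arrow-asym : ∀ i j → + 0 < q i j → ¬ (+ 0 < q j i)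
  arrow-asym i j i→j j→i = <-asym i→j (subst (_< + 0) (sym (isQ i j)) (neg-mono-< j→i))

  arrow⇒≢ : ∀ {i j} → + 0 < q i j → i ≢ j
  arrow⇒≢ {i} i→i refl = <-irrefl (sym (quiver-diag i)) i→i

  ≥2-oriented : ∀ {i j} → + 0 < q i j → + 2 ≤ q i j ⊎ + 2 ≤ q j i → + 2 ≤ q i j
  ≥2-oriented i→j (inj₁ 2≤qij) = 2≤qij
  ≥2-oriented i→j (inj₂ 2≤qji) = ⊥-elim (arrow-asym _ _ i→j (2≤⇒0< 2≤qji))

  ∣∣-sym : ∀ i j → ∣ q i j ∣ ≡ ∣ q j i ∣
  ∣∣-sym i j = trans (cong ∣_∣ (isQ i j)) (∣-i∣≡∣i∣ (q j i))

μ-atˡ : ∀ {n} (v : Fin n) (q : Mat n) b → μ v q v b ≡ - q v b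
μ-atˡ v q b with v ≟ v
... | yes _ = refl
... | no v≢v = ⊥-elim (v≢v refl)

μ-atʳ : ∀ {n} (v : Fin n) (q : Mat n) a → μ v q a v ≡ - q a v
μ-atʳ v q a with v ≟ a | v ≟ v
... | yes _ | _ = refl
... | no _ | yes _ = refl
... | no _ | no v≢v = ⊥-elim (v≢v refl)

μ-off : ∀ {n} (v : Fin n) (q : Mat n) {a b} → v ≢ a → v ≢ b →
  μ v q a b ≡ q a b + [ q a v ]⁺ * [ q v b ]⁺ - [ q b v ]⁺ * [ q v a ]⁺
μ-off v q {a} {b} v≢a v≢b with v ≟ a | v ≟ b
... | yes v≡a | _ = ⊥-elim (v≢a v≡a)
... | no _ | yes v≡b = ⊥-elim (v≢b v≡b)
... | no _ | no _ = refl

μ-isQuiver : ∀ {n} (v : Fin n) {q : Mat n} → IsQuiver q → IsQuiver (μ v q)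
μ-isQuiver v {q} isQ a b with v ≟ a | v ≟ b
... | yes _ | yes _ = cong -_ (isQ a b)
... | yes _ | no _ = cong -_ (isQ a b)
... | no _ | yes _ = cong -_ (isQ a b)
... | no _ | no _ =
  trans (cong (λ z → z + [ q a v ]⁺ * [ q v b ]⁺ - [ q b v ]⁺ * [ q v a ]⁺) (isQ a b))
        (regroup (q b a) ([ q a v ]⁺ * [ q v b ]⁺) ([ q b v ]⁺ * [ q v a ]⁺))
  where
  regroup : ∀ x y z → - x + y - z ≡ - (x + z - y)
  regroup = solve-∀

module _ {n} (v : Fin n) {q : Mat n} where

  μ-off-oneway : ∀ {a b} → v ≢ a → v ≢ b → (+ 0 < q b v → + 0 < q v a → ⊥) →
    μ v q a b ≡ q a b + [ q a v ]⁺ * [ q v b ]⁺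
  μ-off-oneway {a} {b} v≢a v≢b no-b→v→a = trans (μ-off v q v≢a v≢b)
    (trans (cong (λ z → q a b + [ q a v ]⁺ * [ q v b ]⁺ - z) ([]⁺*[]⁺≡0 _ _ no-b→v→a)) (+-identityʳ _))

  μ-unchanged : ∀ {a b} → v ≢ a → v ≢ b →
    (+ 0 < q a v → + 0 < q v b → ⊥) → (+ 0 < q b v → + 0 < q v a → ⊥) → μ v q a b ≡ q a b
  μ-unchanged {a} {b} v≢a v≢b no-a→v→b no-b→v→a = trans (μ-off-oneway v≢a v≢b no-b→v→a)
    (trans (cong (λ z → q a b + z) ([]⁺*[]⁺≡0 _ _ no-a→v→b)) (+-identityʳ _))

  module _ (isQ : IsQuiver q) where

    μ-through : ∀ {a b} → + 0 < q a v → + 0 < q v b → μ v q a b ≡ q a b + q a v * q v b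
    μ-through {a} {b} a→v v→b =
      trans (μ-off-oneway (λ v≡a → arrow⇒≢ isQ a→v (sym v≡a)) (arrow⇒≢ isQ v→b)
                          (λ b→v _ → arrow-asym isQ _ _ v→b b→v))
            (cong₂ (λ s t → q a b + s * t) ([]⁺-pos a→v) ([]⁺-pos v→b))

    μ-flipˡ : ∀ x → μ v q v x ≡ q x v
    μ-flipˡ x = trans (μ-atˡ v q x) (sym (isQ x v))

    μ-flipʳ : ∀ x → μ v q x v ≡ q v x
    μ-flipʳ x = trans (μ-atʳ v q x) (sym (isQ v x))

∣∣≤∣μ∣ : ∀ {n} {q : Mat n} → IsQuiver q → ∀ v a b →
  (+ 0 < q a v → + 0 < q v b → ∣ q a b ∣ ≤ℕ ∣ μ v q a b ∣) →
  (+ 0 < q b v → + 0 < q v a → ∣ q b a ∣ ≤ℕ ∣ μ v q b a ∣) → ∣ q a b ∣ ≤ℕ ∣ μ v q a b ∣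
∣∣≤∣μ∣ {q = q} isQ v a b through-ab through-ba = by-cases (v ≟ a) (v ≟ b)
  where
  by-cases : Dec (v ≡ a) → Dec (v ≡ b) → ∣ q a b ∣ ≤ℕ ∣ μ v q a b ∣
  by-cases (yes refl) _ = ℕₚ.≤-reflexive (sym (trans (cong ∣_∣ (μ-atˡ v q b)) (∣-i∣≡∣i∣ (q v b))))
  by-cases (no _) (yes refl) = ℕₚ.≤-reflexive (sym (trans (cong ∣_∣ (μ-atʳ v q a)) (∣-i∣≡∣i∣ (q a v))))
  by-cases (no v≢a) (no v≢b) with (+ 0 <? q a v) ×-dec (+ 0 <? q v b) | (+ 0 <? q b v) ×-dec (+ 0 <? q v a)
  ... | yes (a→v , v→b) | _ = through-ab a→v v→b
  ... | no _ | yes (b→v , v→a) =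
    subst₂ _≤ℕ_ (∣∣-sym isQ b a) (∣∣-sym (μ-isQuiver v isQ) b a) (through-ba b→v v→a)
  ... | no ¬a→v→b | no ¬b→v→a = ℕₚ.≤-reflexive (cong ∣_∣ (sym (μ-unchanged v v≢a v≢b
        (λ a→v v→b → ¬a→v→b (a→v , v→b)) (λ b→v v→a → ¬b→v→a (b→v , v→a)))))

-- Walks and acyclicity

module _ {n} {q : Mat n} {S : VSet n} where

  walk-start : ∀ {i j} → Walk q S i j → i ∈ S
  walk-start (edge i∈S _ _) = i∈S
  walk-start (step i∈S _ _) = i∈S

  walk-snoc : ∀ {a b c} → Walk q S a b → + 0 < q b c → c ∈ S → Walk q S a c
  walk-snoc (edge a∈S b∈S a→b) b→c c∈S = step a∈S a→b (edge b∈S c∈S b→c)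
  walk-snoc (step a∈S a→x walk) b→c c∈S = step a∈S a→x (walk-snoc walk b→c c∈S)

  Acyclic⇒no-3-cycle : Acyclic q S → ∀ {x r y} → x ∈ S → r ∈ S → y ∈ S →
    + 0 < q x r → + 0 < q r y → + 0 < q y x → ⊥
  Acyclic⇒no-3-cycle acyclic x∈S r∈S y∈S x→r r→y y→x =
    acyclic _ (step x∈S x→r (step r∈S r→y (edge y∈S x∈S y→x)))

  Acyclic⇒3-path< : Acyclic q S → ∀ {x r y} → x ∈ S → r ∈ S → y ∈ S →
    + 0 < q x r → + 0 < q r y → q y x < q x r
  Acyclic⇒3-path< acyclic {x} {r} {y} x∈S r∈S y∈S x→r r→y with + 0 <? q y x
  ... | yes y→x = ⊥-elim (Acyclic⇒no-3-cycle acyclic x∈S r∈S y∈S x→r r→y y→x)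
  ... | no y↛x = nonpos<pos y↛x x→r

walk-map : ∀ {n} {q q' : Mat n} {S S' : VSet n} → S ⊆ S' →
  (∀ {i j} → i ∈ S → j ∈ S → + 0 < q i j → + 0 < q' i j) →
  ∀ {i j} → Walk q S i j → Walk q' S' i j
walk-map S⊆S' arrows (edge i∈S j∈S i→j) = edge (S⊆S' i∈S) (S⊆S' j∈S) (arrows i∈S j∈S i→j)
walk-map S⊆S' arrows (step i∈S i→j walk) =
  step (S⊆S' i∈S) (arrows i∈S (walk-start walk) i→j) (walk-map S⊆S' arrows walk)

Acyclic-mono : ∀ {n} {q q' : Mat n} {S S' : VSet n} → S ⊆ S' →
  (∀ {i j} → i ∈ S → j ∈ S → + 0 < q i j → + 0 < q' i j) → Acyclic q' S' → Acyclic q S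
Acyclic-mono S⊆S' arrows acyclic i cycle = acyclic i (walk-map S⊆S' arrows cycle)

Acyclic-⊆ : ∀ {n} {q : Mat n} {S S' : VSet n} → S ⊆ S' → Acyclic q S' → Acyclic q S
Acyclic-⊆ S⊆S' = Acyclic-mono S⊆S' (λ _ _ i→j → i→j)

module _ {n} {q : Mat n} {S : VSet n} {v : Fin n} where

  private
    into-source : (∀ j → j ∈ S → ¬ (+ 0 < q j v)) → ∀ {i} → Walk q S i v → ⊥
    into-source no-in (edge i∈S _ i→v) = no-in _ i∈S i→v
    into-source no-in (step _ _ walk) = into-source no-in walk

    avoid-source : (∀ j → j ∈ S → ¬ (+ 0 < q j v)) →
      ∀ {i j} → Walk q S i j → i ≢ v → Walk q (S ∖ v) i j
    avoid-source no-in {i} (edge i∈S j∈S i→j) i≢v =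
      edge (i∈S , i≢v) (j∈S , λ j≡v → no-in i i∈S (subst (λ z → + 0 < q i z) j≡v i→j)) i→j
    avoid-source no-in {i} (step i∈S i→j walk) i≢v =
      step (i∈S , i≢v) i→j
        (avoid-source no-in walk (λ j≡v → no-in i i∈S (subst (λ z → + 0 < q i z) j≡v i→j)))

    out-of-sink : (∀ j → j ∈ S → ¬ (+ 0 < q v j)) → ∀ {j} → Walk q S v j → ⊥
    out-of-sink no-out (edge _ j∈S v→j) = no-out _ j∈S v→j
    out-of-sink no-out (step _ v→j walk) = no-out _ (walk-start walk) v→j

    avoid-sink : (∀ j → j ∈ S → ¬ (+ 0 < q v j)) →
      ∀ {i j} → Walk q S i j → i ≢ v → j ≢ v → Walk q (S ∖ v) i j
    avoid-sink no-out (edge i∈S j∈S i→j) i≢v j≢v = edge (i∈S , i≢v) (j∈S , j≢v) i→j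
    avoid-sink no-out (step {j = x} i∈S i→x walk) i≢v j≢v with x ≟ v
    ... | yes refl = ⊥-elim (out-of-sink no-out walk)
    ... | no x≢v = step (i∈S , i≢v) i→x (avoid-sink no-out walk x≢v j≢v)

  Acyclic-source : (∀ j → j ∈ S → ¬ (+ 0 < q j v)) → Acyclic q (S ∖ v) → Acyclic q S
  Acyclic-source no-in acyclic i cycle with i ≟ v
  ... | yes refl = into-source no-in cycle
  ... | no i≢v = acyclic i (avoid-source no-in cycle i≢v)

  Acyclic-sink : (∀ j → j ∈ S → ¬ (+ 0 < q v j)) → Acyclic q (S ∖ v) → Acyclic q S
  Acyclic-sink no-out acyclic i cycle with i ≟ v
  ... | yes refl = out-of-sink no-out cycle
  ... | no i≢v = acyclic i (avoid-sink no-out cycle i≢v i≢v)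

-- Counting arrows

sumList≡sum : ∀ {n} (f : Fin n → ℕ) → sumList (map f (allFin n)) ≡ sum f
sumList≡sum {n} f = trans (cong sumList (map-tabulate id f)) (tabulate-sum n f)
  where
  tabulate-sum : ∀ n (f : Fin n → ℕ) → sumList (tabulate f) ≡ sum f
  tabulate-sum ℕ.zero f = refl
  tabulate-sum (ℕ.suc n) f = cong (f zero ℕ.+_) (tabulate-sum n (f ∘ suc))

sum-mono-≤ : ∀ {n} {f g : Fin n → ℕ} → (∀ x → f x ≤ℕ g x) → sum f ≤ℕ sum g
sum-mono-≤ {ℕ.zero} f≤g = z≤n
sum-mono-≤ {ℕ.suc n} f≤g = ℕₚ.+-mono-≤ (f≤g zero) (sum-mono-≤ (f≤g ∘ suc))

sum-mono-< : ∀ {n} {f g : Fin n → ℕ} → (∀ x → f x ≤ℕ g x) → ∀ x → f x <ℕ g x → sum f <ℕ sum g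
sum-mono-< {ℕ.suc n} f≤g zero f<g = ℕₚ.+-mono-<-≤ f<g (sum-mono-≤ (f≤g ∘ suc))
sum-mono-< {ℕ.suc n} f≤g (suc x) f<g = ℕₚ.+-mono-≤-< (f≤g zero) (sum-mono-< (f≤g ∘ suc) x f<g)

sum-updateAt : ∀ {n} (F : Fin n → ℕ) (k : Fin n) (f : ℕ → ℕ) →
  sum (updateAt F k f) ℕ.+ F k ≡ sum F ℕ.+ f (F k)
sum-updateAt F zero f = regroup (f (F zero)) (sum (F ∘ suc)) (F zero)
  where
  regroup : ∀ a b c → a ℕ.+ b ℕ.+ c ≡ c ℕ.+ b ℕ.+ a
  regroup = ℕ-Solver.solve-∀
sum-updateAt F (suc k) f = begin
  F zero ℕ.+ sum (updateAt (F ∘ suc) k f) ℕ.+ F (suc k)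
    ≡⟨ ℕₚ.+-assoc (F zero) _ _ ⟩
  F zero ℕ.+ (sum (updateAt (F ∘ suc) k f) ℕ.+ F (suc k))
    ≡⟨ cong (F zero ℕ.+_) (sum-updateAt (F ∘ suc) k f) ⟩
  F zero ℕ.+ (sum (F ∘ suc) ℕ.+ f (F (suc k)))
    ≡⟨ ℕₚ.+-assoc (F zero) _ _ ⟨
  F zero ℕ.+ sum (F ∘ suc) ℕ.+ f (F (suc k)) ∎
  where open ≡-Reasoning

sum-drop : ∀ {n} (F : Fin n → ℕ) (k : Fin n) → sum (updateAt F k (const 0)) ℕ.+ F k ≡ sum F
sum-drop F k = trans (sum-updateAt F k (const 0)) (ℕₚ.+-identityʳ (sum F))

module _ {n} {k j : Fin n} (j≢k : j ≢ k) where

  private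
    drop₂ : (Fin n → ℕ) → Fin n → ℕ
    drop₂ H = updateAt (updateAt H k (const 0)) j (const 0)

    sum+at≡ : ∀ H → sum H ℕ.+ H k ≡ sum (drop₂ H) ℕ.+ (H k ℕ.+ H k ℕ.+ H j)
    sum+at≡ H = begin
      sum H ℕ.+ H k
        ≡⟨ cong (ℕ._+ H k) (sum-drop H k) ⟨
      sum H₁ ℕ.+ H k ℕ.+ H k
        ≡⟨ cong (λ z → z ℕ.+ H k ℕ.+ H k) (sum-drop H₁ j) ⟨
      sum (drop₂ H) ℕ.+ H₁ j ℕ.+ H k ℕ.+ H k
        ≡⟨ cong (λ z → sum (drop₂ H) ℕ.+ z ℕ.+ H k ℕ.+ H k) (updateAt-minimal j k H j≢k) ⟩
      sum (drop₂ H) ℕ.+ H j ℕ.+ H k ℕ.+ H k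
        ≡⟨ regroup (sum (drop₂ H)) (H j) (H k) ⟩
      sum (drop₂ H) ℕ.+ (H k ℕ.+ H k ℕ.+ H j) ∎
      where
      open ≡-Reasoning
      H₁ = updateAt H k (const 0)
      regroup : ∀ s a b → s ℕ.+ a ℕ.+ b ℕ.+ b ≡ s ℕ.+ (b ℕ.+ b ℕ.+ a)
      regroup = ℕ-Solver.solve-∀

    drop₂-mono : ∀ {F G} → (∀ b → b ≢ k → b ≢ j → F b ≤ℕ G b) → ∀ b → drop₂ F b ≤ℕ drop₂ G b
    drop₂-mono {F} {G} F≤G b with b ≟ j
    ... | yes refl = ℕₚ.≤-reflexive (trans (updateAt-updates j _) (sym (updateAt-updates j _)))
    ... | no b≢j with b ≟ k
    ...   | yes refl = ℕₚ.≤-reflexive (trans (updateAt-minimal b j _ b≢j)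
                         (trans (updateAt-updates k F)
                           (sym (trans (updateAt-minimal b j _ b≢j) (updateAt-updates k G)))))
    ...   | no b≢k = subst₂ _≤ℕ_
                       (sym (trans (updateAt-minimal b j _ b≢j) (updateAt-minimal b k F b≢k)))
                       (sym (trans (updateAt-minimal b j _ b≢j) (updateAt-minimal b k G b≢k)))
                       (F≤G b b≢k b≢j)

  sum+at-< : ∀ {F G : Fin n → ℕ} → (∀ b → b ≢ k → b ≢ j → F b ≤ℕ G b) →
    F k ℕ.+ F k ℕ.+ F j <ℕ G k ℕ.+ G k ℕ.+ G j → sum F ℕ.+ F k <ℕ sum G ℕ.+ G k
  sum+at-< {F} {G} F≤G at-< = subst₂ _<ℕ_ (sym (sum+at≡ F)) (sym (sum+at≡ G))
    (ℕₚ.+-mono-≤-< (sum-mono-≤ (drop₂-mono F≤G)) at-<)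

∑∑ : ∀ {n} → (Fin n → Fin n → ℕ) → ℕ
∑∑ f = sum (λ i → sum (f i))

∑∑-mono-< : ∀ {n} {f g : Fin n → Fin n → ℕ} → (∀ a b → f a b ≤ℕ g a b) →
  ∀ a b → f a b <ℕ g a b → ∑∑ f <ℕ ∑∑ g
∑∑-mono-< f≤g a b f<g = sum-mono-< (λ i → sum-mono-≤ (f≤g i)) a (sum-mono-< (f≤g a) b f<g)

∑∑-by-column : ∀ {n} (h : Fin n → Fin n → ℕ) → (∀ a b → h a b ≡ h b a) → ∀ k →
  ∑∑ h ≡ sum (λ a → updateAt (λ a' → sum (h a')) k (const 0) a ℕ.+ h a k)
∑∑-by-column h h-sym k = begin
  ∑∑ h
    ≡⟨ sum-drop rows k ⟨
  sum (updateAt rows k (const 0)) ℕ.+ sum (h k)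
    ≡⟨ cong (sum (updateAt rows k (const 0)) ℕ.+_) (sum-cong-≗ (h-sym k)) ⟩
  sum (updateAt rows k (const 0)) ℕ.+ sum (λ a → h a k)
    ≡⟨ ∑-distrib-+ (updateAt rows k (const 0)) (λ a → h a k) ⟨
  sum (λ a → updateAt rows k (const 0) a ℕ.+ h a k) ∎
  where
  open ≡-Reasoning
  rows = λ a → sum (h a)

numArrows≡∑∑ : ∀ {n} (q : Mat n) → numArrows q ≡ ∑∑ (λ i j → ∣ [ q i j ]⁺ ∣)
numArrows≡∑∑ {n} q = trans (sumList≡sum (λ i → sumList (map (λ j → ∣ [ q i j ]⁺ ∣) (allFin n))))
  (sum-cong-≗ (λ i → sumList≡sum (λ j → ∣ [ q i j ]⁺ ∣)))

∣[]⁺∣+∣[-]⁺∣ : ∀ x → ∣ [ x ]⁺ ∣ ℕ.+ ∣ [ - x ]⁺ ∣ ≡ ∣ x ∣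
∣[]⁺∣+∣[-]⁺∣ (+ ℕ.zero) = refl
∣[]⁺∣+∣[-]⁺∣ (+ ℕ.suc m) = ℕₚ.+-identityʳ _
∣[]⁺∣+∣[-]⁺∣ -[1+ m ] = refl

numArrows-double : ∀ {n} {q : Mat n} → IsQuiver q →
  numArrows q ℕ.+ numArrows q ≡ ∑∑ (λ i j → ∣ q i j ∣)
numArrows-double {q = q} isQ = begin
  numArrows q ℕ.+ numArrows q
    ≡⟨ cong₂ ℕ._+_ (numArrows≡∑∑ q) (trans (numArrows≡∑∑ q) (∑-comm out)) ⟩
  ∑∑ out ℕ.+ ∑∑ (λ i j → out j i)
    ≡⟨ ∑-distrib-+ (λ i → sum (out i)) (λ i → sum (λ j → out j i)) ⟨
  sum (λ i → sum (out i) ℕ.+ sum (λ j → out j i))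
    ≡⟨ sum-cong-≗ (λ i → sym (∑-distrib-+ (out i) (λ j → out j i))) ⟩
  ∑∑ (λ i j → out i j ℕ.+ out j i)
    ≡⟨ sum-cong-≗ (λ i → sum-cong-≗ (λ j →
         trans (cong (λ z → out i j ℕ.+ ∣ [ z ]⁺ ∣) (isQ j i)) (∣[]⁺∣+∣[-]⁺∣ (q i j)))) ⟩
  ∑∑ (λ i j → ∣ q i j ∣) ∎
  where
  open ≡-Reasoning
  out = λ i j → ∣ [ q i j ]⁺ ∣

half-< : ∀ {m n} → m ℕ.+ m <ℕ n ℕ.+ n → m <ℕ n
half-< {m} {n} m+m<n+n with m ℕ.<? n
... | yes m<n = m<n
... | no m≮n = ⊥-elim (ℕₚ.<-irrefl refl
                 (ℕₚ.<-≤-trans m+m<n+n (ℕₚ.+-mono-≤ (ℕₚ.≮⇒≥ m≮n) (ℕₚ.≮⇒≥ m≮n))))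

RowPlusColumn : ∀ {n} → Mat n → Fin n → Fin n → ℕ
RowPlusColumn p k a = sum (λ b → ∣ p a b ∣) ℕ.+ ∣ p a k ∣

module _ {n} {q q' : Mat n} (isQ : IsQuiver q) (isQ' : IsQuiver q') where

  numArrows-<-entrywise : (∀ a b → ∣ q a b ∣ ≤ℕ ∣ q' a b ∣) →
    ∀ a b → ∣ q a b ∣ <ℕ ∣ q' a b ∣ → numArrows q <ℕ numArrows q'
  numArrows-<-entrywise ∣q∣≤∣q'∣ a b ∣q∣<∣q'∣ = half-<
    (subst₂ _<ℕ_ (sym (numArrows-double isQ)) (sym (numArrows-double isQ'))
      (∑∑-mono-< ∣q∣≤∣q'∣ a b ∣q∣<∣q'∣))

  -- Row a plus entry (a, k), summed over a ≠ k, counts every |q a b| twice because row k equals column k.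
  numArrows-<-by-rows : ∀ k → (∀ a → a ≢ k → RowPlusColumn q k a ≤ℕ RowPlusColumn q' k a) →
    ∀ a → a ≢ k → RowPlusColumn q k a <ℕ RowPlusColumn q' k a → numArrows q <ℕ numArrows q'
  numArrows-<-by-rows k ≤-off-k a a≢k <-at-a = half-<
    (subst₂ _<ℕ_ (sym (trans (numArrows-double isQ) (∑∑-by-column _ (∣∣-sym isQ) k)))
                 (sym (trans (numArrows-double isQ') (∑∑-by-column _ (∣∣-sym isQ') k)))
      (sum-mono-< pointwise a (off-k _<ℕ_ a≢k <-at-a)))
    where
    besides-k : Mat n → Fin n → ℕ
    besides-k p a = updateAt (λ a' → sum (λ b → ∣ p a' b ∣)) k (const 0) a ℕ.+ ∣ p a k ∣
    off-k : ∀ (R : ℕ → ℕ → Set) {a} → a ≢ k →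
      R (RowPlusColumn q k a) (RowPlusColumn q' k a) → R (besides-k q a) (besides-k q' a)
    off-k R {a} a≢k = subst₂ R
      (cong (ℕ._+ ∣ q a k ∣) (sym (updateAt-minimal a k _ a≢k)))
      (cong (ℕ._+ ∣ q' a k ∣) (sym (updateAt-minimal a k _ a≢k)))
    pointwise : ∀ a → besides-k q a ≤ℕ besides-k q' a
    pointwise a with a ≟ k
    ... | yes refl = subst (ℕ._≤ besides-k q' a)
                       (sym (cong₂ ℕ._+_ (updateAt-updates a _) (cong ∣_∣ (quiver-diag isQ a)))) z≤n
    ... | no a≢k = off-k _≤ℕ_ a≢k (≤-off-k a a≢k)

-- Opposite quivers

IsOpposite : ∀ {n} → Mat n → Mat n → Set
IsOpposite q q' = ∀ a b → q' a b ≡ q b a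

IsOpposite-sym : ∀ {n} {q q' : Mat n} → IsOpposite q q' → IsOpposite q' q
IsOpposite-sym op a b = sym (op b a)

μ-opposite : ∀ {n} {q q' : Mat n} (v : Fin n) → IsOpposite q q' → IsOpposite (μ v q) (μ v q')
μ-opposite {q = q} {q'} v op a b with v ≟ a | v ≟ b
... | yes _ | yes _ = cong -_ (op a b)
... | yes _ | no _ = cong -_ (op a b)
... | no _ | yes _ = cong -_ (op a b)
... | no _ | no _ = cong₂ _-_
  (cong₂ _+_ (op a b) (trans (cong₂ (λ x y → [ x ]⁺ * [ y ]⁺) (op a v) (op v b))
                             (*-comm [ q v a ]⁺ [ q b v ]⁺)))
  (trans (cong₂ (λ x y → [ x ]⁺ * [ y ]⁺) (op b v) (op v a)) (*-comm [ q v b ]⁺ [ q a v ]⁺))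

module _ {n} {q q' : Mat n} (op : IsOpposite q q') where

  arrow-op : ∀ {a b} → + 0 < q b a → + 0 < q' a b
  arrow-op = subst (+ 0 <_) (sym (op _ _))

  arrow-unop : ∀ {a b} → + 0 < q' a b → + 0 < q b a
  arrow-unop = subst (+ 0 <_) (op _ _)

  walk-op : ∀ {S i j} → Walk q S i j → Walk q' S j i
  walk-op (edge i∈S j∈S i→j) = edge j∈S i∈S (arrow-op i→j)
  walk-op (step i∈S i→j walk) = walk-snoc (walk-op walk) (arrow-op i→j) i∈S

  Acyclic-op : ∀ {S} → Acyclic q' S → Acyclic q S
  Acyclic-op acyclic i cycle = acyclic i (walk-op cycle)

  Abundant-op : ∀ {S} → Abundant q S → Abundant q' S
  Abundant-op abundant i j i∈S j∈S i≢j =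
    swap (Data.Sum.map (subst (+ 2 ≤_) (sym (op j i))) (subst (+ 2 ≤_) (sym (op i j)))
           (abundant i j i∈S j∈S i≢j))

  In⇒Out-op : ∀ {S v x} → x ∈ In q S v → x ∈ Out q' S v
  In⇒Out-op (x∈S , x→v) = x∈S , arrow-op x→v

  Out⇒In-op : ∀ {S v x} → x ∈ Out q S v → x ∈ In q' S v
  Out⇒In-op (x∈S , v→x) = x∈S , arrow-op v→x

  Between-op : ∀ {k k' x} → x ∈ Between q k k' → x ∈ Between q' k k'
  Between-op (inj₁ (k→x , x→k')) = inj₂ (arrow-op x→k' , arrow-op k→x)
  Between-op (inj₂ (k'→x , x→k)) = inj₁ (arrow-op x→k , arrow-op k'→x)

  Source⇒Sink-op : ∀ {S v} → Source q S v → Sink q' S v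
  Source⇒Sink-op (v∈S , no-in) = v∈S , λ j j∈S v→j → no-in j j∈S (arrow-unop v→j)

  Sink⇒Source-op : ∀ {S v} → Sink q S v → Source q' S v
  Sink⇒Source-op (v∈S , no-out) = v∈S , λ j j∈S j→v → no-out j j∈S (arrow-unop j→v)

  WingArrowCond-op : ∀ {k k'} → WingArrowCond q k k' → WingArrowCond q' k k'
  WingArrowCond-op {k} {k'} (cond-out , cond-in) =
    (λ i k→i i→k' k'k≡1 → subst₂ (λ u v → u + + 2 ≤ v) (sym (op k i)) (sym (op i k'))
      (cond-in i (arrow-unop k→i) (arrow-unop i→k') (trans (sym (op k' k)) k'k≡1))) ,
    (λ i i→k k'→i kk'≡1 → subst₂ (λ u v → u + + 2 ≤ v) (sym (op i k)) (sym (op k' i))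
      (cond-out i (arrow-unop i→k) (arrow-unop k'→i) (trans (sym (op k k')) kk'≡1)))

  numArrows-op : numArrows q' ≡ numArrows q
  numArrows-op = begin
    numArrows q'                        ≡⟨ numArrows≡∑∑ q' ⟩
    ∑∑ (λ i j → ∣ [ q' i j ]⁺ ∣)
      ≡⟨ sum-cong-≗ (λ i → sum-cong-≗ (λ j → cong (λ z → ∣ [ z ]⁺ ∣) (op i j))) ⟩
    ∑∑ (λ i j → ∣ [ q j i ]⁺ ∣)         ≡⟨ ∑-comm (λ i j → ∣ [ q i j ]⁺ ∣) ⟨
    ∑∑ (λ i j → ∣ [ q i j ]⁺ ∣)         ≡⟨ numArrows≡∑∑ q ⟨
    numArrows q                         ∎
    where open ≡-Reasoning

module _ {n} {q q' : Mat n} (op : IsOpposite q q') where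

  private op⁻¹ = IsOpposite-sym op

  Fork-op : ∀ {S r} → Fork q S r → Fork q' S r
  Fork-op {S} {r} (r∈S , abundant , cyclic , return , acyclic-in , acyclic-out) =
    r∈S , Abundant-op op abundant , (λ acyclic → cyclic (Acyclic-op op acyclic)) , return' ,
    Acyclic-⊆ (In⇒Out-op op⁻¹ {S}) (Acyclic-op op⁻¹ acyclic-out) ,
    Acyclic-⊆ (Out⇒In-op op⁻¹ {S}) (Acyclic-op op⁻¹ acyclic-in)
    where
    return' : ∀ i j → i ∈ In q' S r → j ∈ Out q' S r → q' i r < q' j i × q' r j < q' j i
    return' i j i∈In j∈Out with return j i (In⇒Out-op op⁻¹ j∈Out) (Out⇒In-op op⁻¹ i∈In)
    ... | jr<ij , ri<ij = subst₂ _<_ (sym (op i r)) (sym (op j i)) ri<ij ,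
                          subst₂ _<_ (sym (op r j)) (sym (op j i)) jr<ij

  PreFork-op : ∀ {r k k'} → PreFork q r k k' → PreFork q' r k k'
  PreFork-op (k≢k' , fork , fork' , orientation) = k≢k' , Fork-op fork , Fork-op fork' , orientation'
    where
    orientation' : ∀ i → _ → _ → _
    orientation' i i≢k i≢k' with orientation i i≢k i≢k'
    ... | inj₁ (k→i , k'→i) = inj₂ (arrow-op op k→i , arrow-op op k'→i)
    ... | inj₂ (i→k , i→k') = inj₁ (arrow-op op i→k , arrow-op op i→k')

-- Forks created by a mutation

record MutatesToFork {n} (q : Mat n) (S : VSet n) (r : Fin n) : Set where
  field
    isQuiver : IsQuiver q
    r∈S : r ∈ S
    abundant-at-r : ∀ x → x ∈ S → x ≢ r → + 2 ≤ q x r ⊎ + 2 ≤ q r x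
    abundant-In : Abundant q (In q S r)
    abundant-Out : Abundant q (Out q S r)
    acyclic-In : Acyclic q (In q S r)
    acyclic-Out : Acyclic q (Out q S r)
    backward-bound : ∀ x y → x ∈ In q S r → y ∈ Out q S r → q y x < q x r ⊎ q y x < q r y
    in-vertex : ∃ (_∈ In q S r)
    out-vertex : ∃ (_∈ Out q S r)

module _ {n} {q : Mat n} {S : VSet n} {r : Fin n} (hyp : MutatesToFork q S r) where

  open MutatesToFork hyp

  private
    M = μ r q

    In⇒2≤ : ∀ {x} → x ∈ In q S r → + 2 ≤ q x r
    In⇒2≤ {x} (x∈S , x→r) = ≥2-oriented isQuiver x→r (abundant-at-r x x∈S (arrow⇒≢ isQuiver x→r))

    Out⇒2≤ : ∀ {y} → y ∈ Out q S r → + 2 ≤ q r y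
    Out⇒2≤ {y} (y∈S , r→y) =
      ≥2-oriented isQuiver r→y (swap (abundant-at-r y y∈S (λ y≡r → arrow⇒≢ isQuiver r→y (sym y≡r))))

    In-or-Out : ∀ x → x ∈ S → x ≢ r → x ∈ In q S r ⊎ x ∈ Out q S r
    In-or-Out x x∈S x≢r = Data.Sum.map (λ 2≤ → x∈S , 2≤⇒0< 2≤) (λ 2≤ → x∈S , 2≤⇒0< 2≤)
                                       (abundant-at-r x x∈S x≢r)

    through-entry : ∀ {x y} → x ∈ In q S r → y ∈ Out q S r → q r y < M x y × q x r < M x y
    through-entry {x} {y} x∈In y∈Out =
      subst (λ z → q r y < z × q x r < z)
        (sym (trans (μ-through r isQuiver (proj₂ x∈In) (proj₂ y∈Out)) (cong (_+ q x r * q r y) (isQuiver x y))))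
        (through-entry-dominates (In⇒2≤ x∈In) (Out⇒2≤ y∈Out) (backward-bound x y x∈In y∈Out))

    μ-within-In : ∀ {x y} → x ∈ In q S r → y ∈ In q S r → M x y ≡ q x y
    μ-within-In (_ , x→r) (_ , y→r) =
      μ-unchanged r (λ r≡x → arrow⇒≢ isQuiver x→r (sym r≡x)) (λ r≡y → arrow⇒≢ isQuiver y→r (sym r≡y))
        (λ _ r→y → arrow-asym isQuiver _ _ y→r r→y) (λ _ r→x → arrow-asym isQuiver _ _ x→r r→x)

    μ-within-Out : ∀ {x y} → x ∈ Out q S r → y ∈ Out q S r → M x y ≡ q x y
    μ-within-Out (_ , r→x) (_ , r→y) =
      μ-unchanged r (arrow⇒≢ isQuiver r→x) (arrow⇒≢ isQuiver r→y)
        (λ x→r _ → arrow-asym isQuiver _ _ r→x x→r) (λ y→r _ → arrow-asym isQuiver _ _ r→y y→r)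

    In-μ⇒Out : ∀ {x} → x ∈ In M S r → x ∈ Out q S r
    In-μ⇒Out {x} (x∈S , x→r) = x∈S , subst (+ 0 <_) (μ-flipʳ r isQuiver x) x→r

    Out-μ⇒In : ∀ {x} → x ∈ Out M S r → x ∈ In q S r
    Out-μ⇒In {x} (x∈S , r→x) = x∈S , subst (+ 0 <_) (μ-flipˡ r isQuiver x) r→x

    abundant : Abundant M S
    abundant i j i∈S j∈S i≢j with i ≟ r | j ≟ r
    ... | yes refl | yes refl = ⊥-elim (i≢j refl)
    ... | yes refl | no j≢r = Data.Sum.map (subst (+ 2 ≤_) (sym (μ-flipˡ r isQuiver j)))
                                           (subst (+ 2 ≤_) (sym (μ-flipʳ r isQuiver j)))
                                           (abundant-at-r j j∈S j≢r)
    ... | no i≢r | yes refl = Data.Sum.map (subst (+ 2 ≤_) (sym (μ-flipʳ r isQuiver i)))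
                                           (subst (+ 2 ≤_) (sym (μ-flipˡ r isQuiver i)))
                                           (swap (abundant-at-r i i∈S i≢r))
    ... | no i≢r | no j≢r with In-or-Out i i∈S i≢r | In-or-Out j j∈S j≢r
    ...   | inj₁ i∈In | inj₁ j∈In = subst₂ (λ u v → + 2 ≤ u ⊎ + 2 ≤ v)
                                      (sym (μ-within-In i∈In j∈In)) (sym (μ-within-In j∈In i∈In))
                                      (abundant-In i j i∈In j∈In i≢j)
    ...   | inj₂ i∈Out | inj₂ j∈Out = subst₂ (λ u v → + 2 ≤ u ⊎ + 2 ≤ v)
                                      (sym (μ-within-Out i∈Out j∈Out)) (sym (μ-within-Out j∈Out i∈Out))
                                      (abundant-Out i j i∈Out j∈Out i≢j)
    ...   | inj₁ i∈In | inj₂ j∈Out = inj₁ (≤-trans (Out⇒2≤ j∈Out) (<⇒≤ (proj₁ (through-entry i∈In j∈Out))))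
    ...   | inj₂ i∈Out | inj₁ j∈In = inj₂ (≤-trans (Out⇒2≤ i∈Out) (<⇒≤ (proj₁ (through-entry j∈In i∈Out))))

    cyclic : ¬ Acyclic M S
    cyclic acyclic with in-vertex | out-vertex
    ... | x , x∈In | y , y∈Out =
      acyclic r (step r∈S (subst (+ 0 <_) (sym (μ-flipˡ r isQuiver x)) (proj₂ x∈In))
                (step (proj₁ x∈In) (<-trans (proj₂ y∈Out) (proj₁ (through-entry x∈In y∈Out)))
                  (edge (proj₁ y∈Out) r∈S (subst (+ 0 <_) (sym (μ-flipʳ r isQuiver y)) (proj₂ y∈Out)))))

    returns : ∀ i j → i ∈ In M S r → j ∈ Out M S r → M i r < M j i × M r j < M j i
    returns i j i∈In j∈Out with through-entry (Out-μ⇒In j∈Out) (In-μ⇒Out i∈In)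
    ... | ri<ji , jr<ji = subst (_< M j i) (sym (μ-flipʳ r isQuiver i)) ri<ji ,
                          subst (_< M j i) (sym (μ-flipˡ r isQuiver j)) jr<ji

  μ-fork : Fork (μ r q) S r
  μ-fork = r∈S , abundant , cyclic , returns ,
    Acyclic-mono In-μ⇒Out (λ i∈ j∈ i→j → subst (+ 0 <_) (μ-within-Out (In-μ⇒Out i∈) (In-μ⇒Out j∈)) i→j)
      acyclic-Out ,
    Acyclic-mono Out-μ⇒In (λ i∈ j∈ i→j → subst (+ 0 <_) (μ-within-In (Out-μ⇒In i∈) (Out-μ⇒In j∈)) i→j)
      acyclic-In

module _ {n} {q : Mat n} (isQ : IsQuiver q) (r : Fin n)
  (abundant-at-r : ∀ x → x ≢ r → + 2 ≤ q x r ⊎ + 2 ≤ q r x)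
  (backward-bound : ∀ x y → + 0 < q x r → + 0 < q r y → q y x < q x r ⊎ q y x < q r y) where

  private
    M = μ r q

    grows-through : ∀ {a b} → + 0 < q a r → + 0 < q r b → ∣ q a b ∣ <ℕ ∣ M a b ∣
    grows-through {a} {b} a→r r→b =
      subst₂ (λ u v → ∣ u ∣ <ℕ ∣ v ∣) (sym (isQ a b))
        (sym (trans (μ-through r isQ a→r r→b) (cong (_+ q a r * q r b) (isQ a b))))
        (∣through-entry∣-grows
          (≥2-oriented isQ a→r (abundant-at-r a (arrow⇒≢ isQ a→r)))
          (≥2-oriented isQ r→b (swap (abundant-at-r b (λ b≡r → arrow⇒≢ isQ r→b (sym b≡r)))))
          (backward-bound a b a→r r→b))

  numArrows-μ-< : ∀ {x y} → + 0 < q x r → + 0 < q r y → numArrows q <ℕ numArrows (μ r q)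
  numArrows-μ-< x→r r→y = numArrows-<-entrywise isQ (μ-isQuiver r isQ)
    (λ a b → ∣∣≤∣μ∣ isQ r a b (λ a→r r→b → ℕₚ.<⇒≤ (grows-through a→r r→b))
                             (λ b→r r→a → ℕₚ.<⇒≤ (grows-through b→r r→a)))
    _ _ (grows-through x→r r→y)

-- Wings

AbundantOff : ∀ {n} → Mat n → Fin n → Fin n → Set
AbundantOff q k k' = ∀ a b → a ≢ b → ¬ (a ≡ k × b ≡ k') → ¬ (a ≡ k' × b ≡ k) → + 2 ≤ q a b ⊎ + 2 ≤ q b a

Other : ∀ {n} → Fin n → Fin n → VSet n
Other k k' i = i ≢ k × i ≢ k'

module _ {n} {q : Mat n} {k k' : Fin n} (abundant : AbundantOff q k k') where

  AbundantOff⇒Abundant : ∀ {T : VSet n} → (k ∈ T → k' ∈ T → ⊥) → Abundant q T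
  AbundantOff⇒Abundant not-both a b a∈T b∈T a≢b =
    abundant a b a≢b (λ { (refl , refl) → not-both a∈T b∈T }) (λ { (refl , refl) → not-both b∈T a∈T })

  AbundantOff⇒at : ∀ {r} → Other k k' r → ∀ x → x ≢ r → + 2 ≤ q x r ⊎ + 2 ≤ q r x
  AbundantOff⇒at (r≢k , r≢k') x x≢r = abundant x _ x≢r (r≢k' ∘ proj₂) (r≢k ∘ proj₂)

  AbundantOff⇒2≤ : IsQuiver q → ∀ {a b} → Other k k' a ⊎ Other k k' b → + 0 < q a b → + 2 ≤ q a b
  AbundantOff⇒2≤ isQ {a} {b} other a→b =
    ≥2-oriented isQ a→b (abundant a b (arrow⇒≢ isQ a→b) (not-kk' other) (not-k'k other))
    where
    not-kk' : Other k k' a ⊎ Other k k' b → ¬ (a ≡ k × b ≡ k')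
    not-kk' (inj₁ (a≢k , _)) (a≡k , _) = a≢k a≡k
    not-kk' (inj₂ (_ , b≢k')) (_ , b≡k') = b≢k' b≡k'
    not-k'k : Other k k' a ⊎ Other k k' b → ¬ (a ≡ k' × b ≡ k)
    not-k'k (inj₁ (_ , a≢k')) (a≡k' , _) = a≢k' a≡k'
    not-k'k (inj₂ (b≢k , _)) (_ , b≡k) = b≢k b≡k

Conclusion : ∀ {n} (w : Mat n) (k k' : Fin n) → Set
Conclusion w k k' =
    (∀ r → r ≢ k → r ≢ k' → Fork (μ r w) AllV r)
    × Fork (μ k' w) (AllV ∖ k) k'
    × (μ k' w k' k ≡ + 1 → w k k' ≡ + 1 →
         (Between (μ k' w) k k' ≐ In (μ k' w) AllV k') × ∃ (λ i → i ∈ Between (μ k' w) k k'))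
    × (μ k' w k k' ≡ + 1 → w k' k ≡ + 1 →
         (Between (μ k' w) k k' ≐ Out (μ k' w) AllV k') × ∃ (λ i → i ∈ Between (μ k' w) k k'))
    × Abundant (μ k' w) (AllV ∖ k') × Acyclic (μ k' w) (AllV ∖ k')
    × (μ k' w k' k ≡ + 1 → Source (μ k' w) (AllV ∖ k') k)
    × (μ k' w k k' ≡ + 1 → Sink (μ k' w) (AllV ∖ k') k)
    × numArrows w <ℕ numArrows (μ k' w)
    × (∀ r → r ∈ Between (μ k' w) k k' →
         Fork (μ r (μ k' w)) AllV r × numArrows (μ k' w) <ℕ numArrows (μ r (μ k' w)))
    × (∀ r → r ∉ Between (μ k' w) k k' → r ≢ k → r ≢ k' →
         PreFork (μ r (μ k' w)) r k k' × numArrows (μ k' w) <ℕ numArrows (μ r (μ k' w)))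
    × WingArrowCond (μ k' w) k k'

module _ {n} {w w' : Mat n} (op : IsOpposite w w') {k k' : Fin n} where

  private
    op⁻¹ = IsOpposite-sym op
    Q = μ k' w
    Q' = μ k' w'
    opQ : IsOpposite Q Q'
    opQ = μ-opposite k' op
    opQ⁻¹ = IsOpposite-sym opQ

    numArrows-<-op : ∀ {q q' p p' : Mat n} → IsOpposite q q' → IsOpposite p p' →
      numArrows q <ℕ numArrows p → numArrows q' <ℕ numArrows p'
    numArrows-<-op opq opp = subst₂ _<ℕ_ (sym (numArrows-op opq)) (sym (numArrows-op opp))

    between-transfer : ∀ {X X' : VSet n} → X ⊆ X' → X' ⊆ X →
      (Between Q k k' ≐ X) × ∃ (_∈ Between Q k k') → (Between Q' k k' ≐ X') × ∃ (_∈ Between Q' k k')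
    between-transfer X⊆X' X'⊆X ((B⊆X , X⊆B) , i , i∈B) =
      ((λ x∈ → X⊆X' (B⊆X (Between-op opQ⁻¹ x∈))) , (λ x∈ → Between-op opQ (X⊆B (X'⊆X x∈)))) ,
      i , Between-op opQ i∈B

  Wing-op : IsQuiver w → Wing w k k' → Wing w' k k'
  Wing-op isW (∣wkk'∣<2 , between≐ , fork , abundant , acyclic , arrow-cond) =
    subst (_<ℕ 2) (trans (∣∣-sym isW k k') (cong ∣_∣ (sym (op k k')))) ∣wkk'∣<2 ,
    ((λ x∈ → proj₁ between≐ (Between-op op⁻¹ x∈)) , (λ x∈ → Between-op op (proj₂ between≐ x∈))) ,
    Fork-op op fork , Abundant-op op abundant , Acyclic-op op⁻¹ acyclic , WingArrowCond-op op arrow-cond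

  Conclusion-op : Conclusion w k k' → Conclusion w' k k'
  Conclusion-op (forks , fork-∖k , between-In , between-Out , abundant , acyclic , source , sink ,
                 numArrows-< , cyclic-forks , preforks , arrow-cond) =
    (λ r r≢k r≢k' → Fork-op (μ-opposite r op) (forks r r≢k r≢k')) ,
    Fork-op opQ fork-∖k ,
    (λ Q'k'k≡1 w'kk'≡1 → between-transfer (Out⇒In-op opQ) (In⇒Out-op opQ⁻¹)
      (between-Out (trans (sym (opQ k' k)) Q'k'k≡1) (trans (sym (op k k')) w'kk'≡1))) ,
    (λ Q'kk'≡1 w'k'k≡1 → between-transfer (In⇒Out-op opQ) (Out⇒In-op opQ⁻¹)
      (between-In (trans (sym (opQ k k')) Q'kk'≡1) (trans (sym (op k' k)) w'k'k≡1))) ,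
    Abundant-op opQ abundant , Acyclic-op opQ⁻¹ acyclic ,
    (λ Q'k'k≡1 → Sink⇒Source-op opQ (sink (trans (sym (opQ k' k)) Q'k'k≡1))) ,
    (λ Q'kk'≡1 → Source⇒Sink-op opQ (source (trans (sym (opQ k k')) Q'kk'≡1))) ,
    numArrows-<-op op opQ numArrows-< ,
    (λ r r∈B → Data.Product.map (Fork-op (μ-opposite r opQ)) (numArrows-<-op opQ (μ-opposite r opQ))
                 (cyclic-forks r (Between-op opQ⁻¹ r∈B))) ,
    (λ r r∉B r≢k r≢k' → Data.Product.map (PreFork-op (μ-opposite r opQ)) (numArrows-<-op opQ (μ-opposite r opQ))
                 (preforks r (r∉B ∘ Between-op opQ) r≢k r≢k')) ,
    WingArrowCond-op opQ arrow-cond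

module PositiveWing {n} {w : Mat n} {k k' : Fin n} (isW : IsQuiver w) (wing : Wing w k k')
  (k→k' : w k k' ≡ + 1) where

  private
    fork-∖k' : Fork w (AllV ∖ k') k
    fork-∖k' = proj₁ (proj₂ (proj₂ wing))

  abundant-∖k : Abundant w (AllV ∖ k)
  abundant-∖k = proj₁ (proj₂ (proj₂ (proj₂ wing)))

  acyclic-∖k : Acyclic w (AllV ∖ k)
  acyclic-∖k = proj₁ (proj₂ (proj₂ (proj₂ (proj₂ wing))))

  arrow-cond : ∀ i → + 0 < w i k → + 0 < w k' i → w k k' ≡ + 1 → w i k + + 2 ≤ w k' i
  arrow-cond = proj₂ (proj₂ (proj₂ (proj₂ (proj₂ (proj₂ wing)))))

  abundant-∖k' : Abundant w (AllV ∖ k')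
  abundant-∖k' = proj₁ (proj₂ fork-∖k')

  cyclic-∖k' : ¬ Acyclic w (AllV ∖ k')
  cyclic-∖k' = proj₁ (proj₂ (proj₂ fork-∖k'))

  returns-k : ∀ i j → i ∈ In w (AllV ∖ k') k → j ∈ Out w (AllV ∖ k') k → w i k < w j i × w k j < w j i
  returns-k = proj₁ (proj₂ (proj₂ (proj₂ fork-∖k')))

  0<wkk' : + 0 < w k k'
  0<wkk' = subst (+ 0 <_) (sym k→k') (+<+ (s≤s z≤n))

  k≢k' : k ≢ k'
  k≢k' = arrow⇒≢ isW 0<wkk'

  k'≢k : k' ≢ k
  k'≢k = k≢k' ∘ sym

  wk'k≡-1 : w k' k ≡ -[1+ 0 ]
  wk'k≡-1 = trans (isW k' k) (cong -_ k→k')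

  k'↛k : ¬ (+ 0 < w k' k)
  k'↛k = arrow-asym isW k k' 0<wkk'

  -- 2-paths between k and k' parallel to the arrow k → k', or closing a 3-cycle with it.
  Parallel Cyclic : Fin n → Set
  Parallel i = + 0 < w k i × + 0 < w i k'
  Cyclic i = + 0 < w k' i × + 0 < w i k

  classify : ∀ {i} → Other k k' i → Parallel i ⊎ Cyclic i
  classify (i≢k , i≢k') = proj₂ (proj₁ (proj₂ wing)) ((tt , i≢k) , i≢k')

  Parallel⇒Other : ∀ {i} → Parallel i → Other k k' i
  Parallel⇒Other (k→i , i→k') = (λ i≡k → arrow⇒≢ isW k→i (sym i≡k)) , arrow⇒≢ isW i→k'

  Cyclic⇒Other : ∀ {i} → Cyclic i → Other k k' i
  Cyclic⇒Other (k'→i , i→k) = arrow⇒≢ isW i→k , (λ i≡k' → arrow⇒≢ isW k'→i (sym i≡k'))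

  k'→⇒Cyclic : ∀ {i} → + 0 < w k' i → Cyclic i
  k'→⇒Cyclic {i} k'→i with classify {i} ((λ { refl → k'↛k k'→i }) , (λ { refl → arrow⇒≢ isW k'→i refl }))
  ... | inj₁ (_ , i→k') = ⊥-elim (arrow-asym isW _ _ i→k' k'→i)
  ... | inj₂ cyclic = cyclic

  →k⇒Cyclic : ∀ {i} → + 0 < w i k → Cyclic i
  →k⇒Cyclic {i} i→k with classify {i} ((λ { refl → arrow⇒≢ isW i→k refl }) , (λ { refl → k'↛k i→k }))
  ... | inj₁ (k→i , _) = ⊥-elim (arrow-asym isW _ _ k→i i→k)
  ... | inj₂ cyclic = cyclic

  Parallel-by-→k' : ∀ {i} → Other k k' i → + 0 < w i k' → Parallel i
  Parallel-by-→k' other i→k' with classify other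
  ... | inj₁ parallel = parallel
  ... | inj₂ (k'→i , _) = ⊥-elim (arrow-asym isW _ _ k'→i i→k')

  Parallel-by-k→ : ∀ {i} → Other k k' i → + 0 < w k i → Parallel i
  Parallel-by-k→ other k→i with classify other
  ... | inj₁ parallel = parallel
  ... | inj₂ (_ , i→k) = ⊥-elim (arrow-asym isW _ _ i→k k→i)

  Cyclic⇒In : ∀ {i} → Cyclic i → i ∈ In w (AllV ∖ k') k
  Cyclic⇒In cyclic = (tt , proj₂ (Cyclic⇒Other cyclic)) , proj₂ cyclic

  Parallel⇒Out : ∀ {j} → Parallel j → j ∈ Out w (AllV ∖ k') k
  Parallel⇒Out parallel = (tt , proj₂ (Parallel⇒Other parallel)) , proj₁ parallel

  W-abundantOff : AbundantOff w k k'
  W-abundantOff a b a≢b not-kk' not-k'k with a ≟ k | b ≟ k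
  ... | yes refl | _ = abundant-∖k' a b (tt , k≢k') (tt , λ b≡k' → not-kk' (refl , b≡k')) a≢b
  ... | no _ | yes refl = abundant-∖k' a b (tt , λ a≡k' → not-k'k (a≡k' , refl)) (tt , k≢k') a≢b
  ... | no a≢k | no b≢k = abundant-∖k a b (tt , a≢k) (tt , b≢k) a≢b

  W-2≤ : ∀ {a b} → Other k k' a ⊎ Other k k' b → + 0 < w a b → + 2 ≤ w a b
  W-2≤ = AbundantOff⇒2≤ W-abundantOff isW

  Parallel→Cyclic : ∀ {j i} → Parallel j → Cyclic i → + 0 < w j i
  Parallel→Cyclic parallel cyclic =
    <-trans (proj₂ cyclic) (proj₁ (returns-k _ _ (Cyclic⇒In cyclic) (Parallel⇒Out parallel)))

  Parallel⇉Cyclic : ∀ {j i} → Parallel j → Cyclic i → + 2 ≤ w j i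
  Parallel⇉Cyclic parallel cyclic = W-2≤ (inj₂ (Cyclic⇒Other cyclic)) (Parallel→Cyclic parallel cyclic)

  private
    acyclic-∖k'∖k : Acyclic w ((AllV ∖ k') ∖ k)
    acyclic-∖k'∖k = Acyclic-⊆ (λ x∈ → tt , proj₂ x∈) acyclic-∖k

  -- The cycle of the fork W ∖ {k'} must pass through k, entering from a cyclic and leaving to a parallel vertex.
  cyclic-vertex : ∃ Cyclic
  cyclic-vertex with any? (λ i → + 0 <? w i k)
  ... | yes (i , i→k) = i , →k⇒Cyclic i→k
  ... | no none = ⊥-elim (cyclic-∖k' (Acyclic-source (λ j _ j→k → none (j , j→k)) acyclic-∖k'∖k))

  parallel-vertex : ∃ Parallel
  parallel-vertex with any? (λ i → (+ 0 <? w k i) ×-dec ¬? (i ≟ k'))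
  ... | yes (j , k→j , j≢k') = j , Parallel-by-k→ ((λ j≡k → arrow⇒≢ isW k→j (sym j≡k)) , j≢k') k→j
  ... | no none = ⊥-elim (cyclic-∖k' (Acyclic-sink (λ j j∈ k→j → none (j , k→j , proj₂ j∈)) acyclic-∖k'∖k))

  Q : Mat n
  Q = μ k' w

  isQ : IsQuiver Q
  isQ = μ-isQuiver k' isW

  Q-k'→ : ∀ x → Q k' x ≡ w x k'
  Q-k'→ = μ-flipˡ k' isW

  Q-→k' : ∀ x → Q x k' ≡ w k' x
  Q-→k' = μ-flipʳ k' isW

  Qk'k≡1 : Q k' k ≡ + 1
  Qk'k≡1 = trans (Q-k'→ k) k→k'

  Qkk'≡-1 : Q k k' ≡ -[1+ 0 ]
  Qkk'≡-1 = trans (Q-→k' k) wk'k≡-1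

  Other⇒k'≢ : ∀ {i} → Other k k' i → k' ≢ i
  Other⇒k'≢ (_ , i≢k') = i≢k' ∘ sym

  Q-k-Parallel : ∀ {j} → Parallel j → Q k j ≡ w k j
  Q-k-Parallel parallel = μ-unchanged k' k'≢k (Other⇒k'≢ (Parallel⇒Other parallel))
    (λ _ k'→j → arrow-asym isW _ _ (proj₂ parallel) k'→j) (λ _ k'→k → k'↛k k'→k)

  Q-k-Cyclic : ∀ {i} → Cyclic i → Q k i ≡ w k' i - w i k
  Q-k-Cyclic {i} (k'→i , _) = begin
    Q k i                      ≡⟨ μ-through k' isW 0<wkk' k'→i ⟩
    w k i + w k k' * w k' i    ≡⟨ cong₂ (λ u v → u + v * w k' i) (isW k i) k→k' ⟩
    - w i k + + 1 * w k' i     ≡⟨ regroup (w i k) (w k' i) ⟩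
    w k' i - w i k             ∎
    where
    open ≡-Reasoning
    regroup : ∀ x y → - x + + 1 * y ≡ y - x
    regroup = solve-∀

  Q-2≤-k→ : ∀ {j} → Other k k' j → + 2 ≤ Q k j
  Q-2≤-k→ other with classify other
  ... | inj₁ parallel = subst (+ 2 ≤_) (sym (Q-k-Parallel parallel)) (W-2≤ (inj₂ other) (proj₁ parallel))
  ... | inj₂ cyclic@(k'→j , j→k) = subst (+ 2 ≤_) (sym (Q-k-Cyclic cyclic))
    (≤-by-gap _ (gap (w _ k) (w k' _)) (0≤gap (arrow-cond _ j→k k'→j k→k')))
    where
    gap : ∀ x y → y - x ≡ + 2 + (y - (x + + 2))
    gap = solve-∀

  Q-k→ : ∀ {j} → Other k k' j → + 0 < Q k j
  Q-k→ other = 2≤⇒0< (Q-2≤-k→ other)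

  Q-↛k : ∀ {j} → Other k k' j → ¬ (+ 0 < Q j k)
  Q-↛k other = arrow-asym isQ _ _ (Q-k→ other)

  Q-⇉-Other : ∀ {a b} → Other k k' a → Other k k' b → + 2 ≤ w a b → + 2 ≤ Q a b
  Q-⇉-Other {a} {b} other-a other-b 2≤wab = subst (+ 2 ≤_) (sym Qab≡)
    (≤-trans 2≤wab (x≤x+[]⁺*[]⁺ (w a b) (w a k') (w k' b)))
    where
    Qab≡ : Q a b ≡ w a b + [ w a k' ]⁺ * [ w k' b ]⁺
    Qab≡ = μ-off-oneway k' (Other⇒k'≢ other-a) (Other⇒k'≢ other-b) λ b→k' k'→a →
      arrow-asym isW _ _ (2≤⇒0< 2≤wab)
        (Parallel→Cyclic (Parallel-by-→k' other-b b→k') (k'→⇒Cyclic k'→a))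

  Q-arrow⇒W-arrow : ∀ {a b} → Other k k' a → Other k k' b → + 0 < Q a b → + 0 < w a b
  Q-arrow⇒W-arrow {a} {b} other-a other-b a→b
    with abundant-∖k a b (tt , proj₁ other-a) (tt , proj₁ other-b) (arrow⇒≢ isQ a→b)
  ... | inj₁ 2≤wab = 2≤⇒0< 2≤wab
  ... | inj₂ 2≤wba = ⊥-elim (arrow-asym isQ _ _ a→b (2≤⇒0< (Q-⇉-Other other-b other-a 2≤wba)))

  Q-abundantOff : AbundantOff Q k k'
  Q-abundantOff a b a≢b not-kk' not-k'k with a ≟ k' | b ≟ k'
  ... | yes refl | yes refl = ⊥-elim (a≢b refl)
  ... | yes refl | no _ = swap (subst₂ (λ u v → + 2 ≤ u ⊎ + 2 ≤ v) (sym (Q-→k' b)) (sym (Q-k'→ b))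
                            (W-abundantOff a b a≢b (k'≢k ∘ proj₁) not-k'k))
  ... | no _ | yes refl = swap (subst₂ (λ u v → + 2 ≤ u ⊎ + 2 ≤ v) (sym (Q-k'→ a)) (sym (Q-→k' a))
                            (W-abundantOff a b a≢b not-kk' (k'≢k ∘ proj₂)))
  ... | no a≢k' | no b≢k' with a ≟ k | b ≟ k
  ...   | yes refl | yes refl = ⊥-elim (a≢b refl)
  ...   | yes refl | no b≢k = inj₁ (Q-2≤-k→ (b≢k , b≢k'))
  ...   | no a≢k | yes refl = inj₂ (Q-2≤-k→ (a≢k , a≢k'))
  ...   | no a≢k | no b≢k = Data.Sum.map (Q-⇉-Other (a≢k , a≢k') (b≢k , b≢k'))
                                        (Q-⇉-Other (b≢k , b≢k') (a≢k , a≢k'))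
                                        (abundant-∖k a b (tt , a≢k) (tt , b≢k) a≢b)

  Q-2≤ : ∀ {a b} → Other k k' a ⊎ Other k k' b → + 0 < Q a b → + 2 ≤ Q a b
  Q-2≤ = AbundantOff⇒2≤ Q-abundantOff isQ

  Q-abundant-∖k' : Abundant Q (AllV ∖ k')
  Q-abundant-∖k' = AbundantOff⇒Abundant Q-abundantOff (λ _ k'∈ → proj₂ k'∈ refl)

  Q-k-source : Source Q (AllV ∖ k') k
  Q-k-source = (tt , k≢k') , no-in
    where
    no-in : ∀ j → j ∈ AllV ∖ k' → ¬ (+ 0 < Q j k)
    no-in j (_ , j≢k') j→k with j ≟ k
    ... | yes refl = arrow⇒≢ isQ j→k refl
    ... | no j≢k = Q-↛k (j≢k , j≢k') j→k

  Q-acyclic-∖k' : Acyclic Q (AllV ∖ k')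
  Q-acyclic-∖k' = Acyclic-source (proj₂ Q-k-source)
    (Acyclic-mono (λ x∈ → tt , proj₂ x∈)
      (λ i∈ j∈ → Q-arrow⇒W-arrow (proj₂ i∈ , proj₂ (proj₁ i∈)) (proj₂ j∈ , proj₂ (proj₁ j∈))) acyclic-∖k)

  Q-→k'⇒Cyclic : ∀ {x} → + 0 < Q x k' → Cyclic x
  Q-→k'⇒Cyclic {x} x→k' = k'→⇒Cyclic (subst (+ 0 <_) (Q-→k' x) x→k')

  Q-between≐In : Between Q k k' ≐ In Q AllV k'
  Q-between≐In = ⊆In , In⊆
    where
    ⊆In : ∀ {x} → x ∈ Between Q k k' → x ∈ In Q AllV k'
    ⊆In (inj₁ (_ , x→k')) = tt , x→k'
    ⊆In {x} (inj₂ (k'→x , x→k)) with x ≟ k | x ≟ k'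
    ... | yes refl | _ = ⊥-elim (arrow⇒≢ isQ x→k refl)
    ... | no _ | yes refl = ⊥-elim (arrow⇒≢ isQ k'→x refl)
    ... | no x≢k | no x≢k' = ⊥-elim (Q-↛k (x≢k , x≢k') x→k)
    In⊆ : ∀ {x} → x ∈ In Q AllV k' → x ∈ Between Q k k'
    In⊆ {x} (_ , x→k') = inj₁ (Q-k→ (x≢k , arrow⇒≢ isQ x→k') , x→k')
      where
      x≢k : x ≢ k
      x≢k refl = k'↛k (subst (+ 0 <_) (Q-→k' k) x→k')

  Q-between-vertex : ∃ (_∈ Between Q k k')
  Q-between-vertex with cyclic-vertex
  ... | i , (k'→i , _) = i , proj₂ Q-between≐In (tt , subst (+ 0 <_) (sym (Q-→k' i)) k'→i)

  Q-arrow-cond : WingArrowCond Q k k'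
  Q-arrow-cond = cond , λ _ _ _ Qkk'≡1 → ⊥-elim (-1≢1 (trans (sym Qkk'≡-1) Qkk'≡1))
    where
    cond : ∀ i → + 0 < Q k i → + 0 < Q i k' → Q k' k ≡ + 1 → Q k i + + 2 ≤ Q i k'
    cond i _ i→k' _ = subst₂ (λ u v → u + + 2 ≤ v) (sym (Q-k-Cyclic cyclic)) (sym (Q-→k' i))
      (≤-by-gap _ (gap (w i k) (w k' i)) (0≤gap (W-2≤ (inj₁ (Cyclic⇒Other cyclic)) (proj₂ cyclic))))
      where
      cyclic = Q-→k'⇒Cyclic i→k'
      gap : ∀ x y → y ≡ y - x + + 2 + (x - + 2)
      gap = solve-∀

  Q-fork-∖k : Fork Q (AllV ∖ k) k'
  Q-fork-∖k = μ-fork record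
    { isQuiver = isW
    ; r∈S = tt , k'≢k
    ; abundant-at-r = λ x x∈ x≢k' → abundant-∖k x k' x∈ (tt , k'≢k) x≢k'
    ; abundant-In = λ x y x∈ y∈ → abundant-∖k x y (proj₁ x∈) (proj₁ y∈)
    ; abundant-Out = λ x y x∈ y∈ → abundant-∖k x y (proj₁ x∈) (proj₁ y∈)
    ; acyclic-In = Acyclic-⊆ proj₁ acyclic-∖k
    ; acyclic-Out = Acyclic-⊆ proj₁ acyclic-∖k
    ; backward-bound = λ x y ((_ , x≢k) , x→k') (_ , k'→y) → inj₁ (nonpos<pos
        (arrow-asym isW _ _ (Parallel→Cyclic (Parallel-by-→k' (x≢k , arrow⇒≢ isW x→k') x→k')
                                              (k'→⇒Cyclic k'→y)))
        x→k')
    ; in-vertex = j , (tt , proj₁ (Parallel⇒Other parallel)) , proj₂ parallel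
    ; out-vertex = i , (tt , proj₁ (Cyclic⇒Other cyclic)) , proj₁ cyclic
    }
    where
    j = proj₁ parallel-vertex
    parallel = proj₂ parallel-vertex
    i = proj₁ cyclic-vertex
    cyclic = proj₂ cyclic-vertex

  module _ {r} (other-r : Other k k' r) where

    private
      not-both-in : + 0 < w k r → + 0 < w k' r → ⊥
      not-both-in k→r k'→r with classify other-r
      ... | inj₁ (_ , r→k') = arrow-asym isW _ _ r→k' k'→r
      ... | inj₂ (_ , r→k) = arrow-asym isW _ _ r→k k→r

      not-both-out : + 0 < w r k → + 0 < w r k' → ⊥
      not-both-out r→k r→k' with classify other-r
      ... | inj₁ (k→r , _) = arrow-asym isW _ _ k→r r→k
      ... | inj₂ (k'→r , _) = arrow-asym isW _ _ k'→r r→k'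

      acyclic-In : Acyclic w (In w AllV r)
      acyclic-In with classify other-r
      ... | inj₁ parallel = Acyclic-source no-in (Acyclic-⊆ (λ x∈ → tt , proj₂ x∈) acyclic-∖k)
        where
        no-in : ∀ j → j ∈ In w AllV r → ¬ (+ 0 < w j k)
        no-in j (_ , j→r) j→k = arrow-asym isW _ _ (Parallel→Cyclic parallel (→k⇒Cyclic j→k)) j→r
      ... | inj₂ (_ , r→k) = Acyclic-⊆ (λ {x} (_ , x→r) → tt , λ { refl → arrow-asym isW _ _ r→k x→r })
                               acyclic-∖k

      acyclic-Out : Acyclic w (Out w AllV r)
      acyclic-Out with classify other-r
      ... | inj₂ cyclic = Acyclic-sink no-out (Acyclic-⊆ (λ x∈ → tt , proj₂ x∈) acyclic-∖k)
        where
        no-out : ∀ j → j ∈ Out w AllV r → ¬ (+ 0 < w k j)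
        no-out j (_ , r→j) k→j = arrow-asym isW _ _ (Parallel→Cyclic (Parallel-by-k→ other-j k→j) cyclic) r→j
          where
          other-j : Other k k' j
          other-j = (λ { refl → arrow⇒≢ isW k→j refl }) , (λ { refl → arrow-asym isW _ _ (proj₁ cyclic) r→j })
      ... | inj₁ (k→r , _) = Acyclic-⊆ (λ {x} (_ , r→x) → tt , λ { refl → arrow-asym isW _ _ k→r r→x })
                               acyclic-∖k

      backward-bound : ∀ x y → x ∈ In w AllV r → y ∈ Out w AllV r → w y x < w x r ⊎ w y x < w r y
      backward-bound x y (_ , x→r) (_ , r→y) with x ≟ k | y ≟ k
      ... | yes refl | yes refl = ⊥-elim (arrow-asym isW _ _ x→r r→y)
      ... | yes refl | no y≢k with y ≟ k'
      ...   | yes refl = inj₁ (subst (_< w k r) (sym wk'k≡-1) (<-trans -<+ x→r))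
      ...   | no y≢k' with classify (y≢k , y≢k')
      ...     | inj₁ (k→y , _) = inj₁ (nonpos<pos (arrow-asym isW _ _ k→y) x→r)
      ...     | inj₂ cyclic =
        inj₂ (proj₁ (returns-k y r (Cyclic⇒In cyclic) (Parallel⇒Out (Parallel-by-k→ other-r x→r))))
      backward-bound x y (_ , x→r) (_ , r→y) | no x≢k | yes refl with x ≟ k'
      ...   | yes refl = inj₁ (subst (_< w k' r) (sym k→k') (2≤⇒1< (W-2≤ (inj₂ other-r) x→r)))
      ...   | no x≢k' with classify (x≢k , x≢k')
      ...     | inj₂ (_ , x→k) = inj₁ (nonpos<pos (arrow-asym isW _ _ x→k) x→r)
      ...     | inj₁ parallel = inj₁ (proj₂ (returns-k r x (Cyclic⇒In (→k⇒Cyclic r→y)) (Parallel⇒Out parallel)))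
      backward-bound x y (_ , x→r) (_ , r→y) | no x≢k | no y≢k =
        inj₁ (Acyclic⇒3-path< acyclic-∖k (tt , x≢k) (tt , proj₁ other-r) (tt , y≢k) x→r r→y)

      in-out-vertices : Σ (Fin n) (λ x → Σ (Fin n) (λ y → x ∈ In w AllV r × y ∈ Out w AllV r))
      in-out-vertices with classify other-r
      ... | inj₁ (k→r , r→k') = k , k' , (tt , k→r) , (tt , r→k')
      ... | inj₂ (k'→r , r→k) = k' , k , (tt , k'→r) , (tt , r→k)

    W-μ-fork : Fork (μ r w) AllV r
    W-μ-fork = μ-fork record
      { isQuiver = isW
      ; r∈S = tt
      ; abundant-at-r = λ x _ → AbundantOff⇒at W-abundantOff other-r x
      ; abundant-In = AbundantOff⇒Abundant W-abundantOff λ (_ , k→r) (_ , k'→r) → not-both-in k→r k'→r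
      ; abundant-Out = AbundantOff⇒Abundant W-abundantOff λ (_ , r→k) (_ , r→k') → not-both-out r→k r→k'
      ; acyclic-In = acyclic-In
      ; acyclic-Out = acyclic-Out
      ; backward-bound = backward-bound
      ; in-vertex = proj₁ in-out-vertices , proj₁ (proj₂ (proj₂ in-out-vertices))
      ; out-vertex = proj₁ (proj₂ in-out-vertices) , proj₂ (proj₂ (proj₂ in-out-vertices))
      }

  module _ {r} (cyclic-r : Cyclic r) where

    private
      other-r : Other k k' r
      other-r = Cyclic⇒Other cyclic-r

      k'↛r : ¬ (+ 0 < Q k' r)
      k'↛r k'→r = arrow-asym isW _ _ (proj₁ cyclic-r) (subst (+ 0 <_) (Q-k'→ r) k'→r)

      r→k' : + 0 < Q r k'
      r→k' = subst (+ 0 <_) (sym (Q-→k' r)) (proj₁ cyclic-r)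

      backward-bound : ∀ x y → + 0 < Q x r → + 0 < Q r y → Q y x < Q x r ⊎ Q y x < Q r y
      backward-bound x y x→r r→y with x ≟ k' | y ≟ k'
      ... | yes refl | _ = ⊥-elim (k'↛r x→r)
      ... | no x≢k' | yes refl with x ≟ k
      ...   | yes refl = inj₁ (subst (_< Q k r) (sym Qk'k≡1) (2≤⇒1< (Q-2≤-k→ other-r)))
      ...   | no x≢k with + 0 <? Q k' x
      ...     | no k'↛x = inj₁ (nonpos<pos k'↛x x→r)
      ...     | yes k'→x = inj₁ (subst₂ _<_ (sym (Q-k'→ x)) (sym (μ-through k' isW x→k' (proj₁ cyclic-r)))
                   (x<c+x*y (Parallel→Cyclic parallel cyclic-r) (<⇒≤ x→k')
                            (2≤⇒1≤ (W-2≤ (inj₂ other-r) (proj₁ cyclic-r)))))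
        where
        x→k' = subst (+ 0 <_) (Q-k'→ x) k'→x
        parallel = Parallel-by-→k' (x≢k , x≢k') x→k'
      backward-bound x y x→r r→y | no x≢k' | no y≢k' =
        inj₁ (Acyclic⇒3-path< Q-acyclic-∖k' (tt , x≢k') (tt , proj₂ other-r) (tt , y≢k') x→r r→y)

      k'-sink-in-Out : ∀ j → j ∈ Out Q AllV r → ¬ (+ 0 < Q k' j)
      k'-sink-in-Out j (_ , r→j) k'→j = arrow-asym isQ _ _
        (2≤⇒0< (Q-⇉-Other other-j other-r (Parallel⇉Cyclic (Parallel-by-→k' other-j j→k') cyclic-r))) r→j
        where
        j→k' = subst (+ 0 <_) (Q-k'→ j) k'→j
        other-j : Other k k' j
        other-j = (λ { refl → Q-↛k other-r r→j }) , (λ { refl → arrow⇒≢ isQ k'→j refl })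

    mutation-at-cyclic : Fork (μ r Q) AllV r × numArrows Q <ℕ numArrows (μ r Q)
    mutation-at-cyclic = μ-fork record
      { isQuiver = isQ
      ; r∈S = tt
      ; abundant-at-r = λ x _ → AbundantOff⇒at Q-abundantOff other-r x
      ; abundant-In = AbundantOff⇒Abundant Q-abundantOff λ _ (_ , k'→r) → k'↛r k'→r
      ; abundant-Out = AbundantOff⇒Abundant Q-abundantOff λ (_ , r→k) _ → Q-↛k other-r r→k
      ; acyclic-In = Acyclic-⊆ (λ {x} (_ , x→r) → tt , λ { refl → k'↛r x→r }) Q-acyclic-∖k'
      ; acyclic-Out = Acyclic-sink k'-sink-in-Out (Acyclic-⊆ (λ x∈ → tt , proj₂ x∈) Q-acyclic-∖k')
      ; backward-bound = λ x y x∈ y∈ → backward-bound x y (proj₂ x∈) (proj₂ y∈)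
      ; in-vertex = k , tt , Q-k→ other-r
      ; out-vertex = k' , tt , r→k'
      } ,
      numArrows-μ-< isQ r (AbundantOff⇒at Q-abundantOff other-r) backward-bound (Q-k→ other-r) r→k'

  module _ {r} (parallel-r : Parallel r) where

    private
      other-r : Other k k' r
      other-r = Parallel⇒Other parallel-r

      r↛k' : ¬ (+ 0 < Q r k')
      r↛k' r→k' = arrow-asym isW _ _ (proj₂ parallel-r) (subst (+ 0 <_) (Q-→k' r) r→k')

      k'→r : + 0 < Q k' r
      k'→r = subst (+ 0 <_) (sym (Q-k'→ r)) (proj₂ parallel-r)

      i₀ = proj₁ cyclic-vertex
      cyclic-i₀ = proj₂ cyclic-vertex

      r→i₀ : + 0 < Q r i₀
      r→i₀ = 2≤⇒0< (Q-⇉-Other other-r (Cyclic⇒Other cyclic-i₀) (Parallel⇉Cyclic parallel-r cyclic-i₀))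

      backward-bound : ∀ x y → + 0 < Q x r → + 0 < Q r y → Q y x < Q x r ⊎ Q y x < Q r y
      backward-bound x y x→r r→y with y ≟ k' | x ≟ k'
      ... | yes refl | _ = ⊥-elim (r↛k' r→y)
      ... | no y≢k' | yes refl with + 0 <? Q y k'
      ...   | no y↛k' = inj₁ (nonpos<pos y↛k' x→r)
      ...   | yes y→k' = inj₂ (subst₂ _<_ (sym (Q-→k' y)) (sym (μ-through k' isW (proj₂ parallel-r) k'→y))
                   (subst (λ z → w k' y < w r y + z) (*-comm (w k' y) (w r k'))
                     (x<c+x*y (Parallel→Cyclic parallel-r cyclic) (<⇒≤ k'→y)
                              (2≤⇒1≤ (W-2≤ (inj₁ other-r) (proj₂ parallel-r))))))
        where
        cyclic = Q-→k'⇒Cyclic y→k'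
        k'→y = proj₁ cyclic
      backward-bound x y x→r r→y | no y≢k' | no x≢k' =
        inj₁ (Acyclic⇒3-path< Q-acyclic-∖k' (tt , x≢k') (tt , proj₂ other-r) (tt , y≢k') x→r r→y)

      k'-source-in-In : ∀ j → j ∈ In Q (AllV ∖ k) r → ¬ (+ 0 < Q j k')
      k'-source-in-In j ((_ , j≢k) , j→r) j→k' = arrow-asym isQ _ _
        (2≤⇒0< (Q-⇉-Other other-r (Cyclic⇒Other cyclic) (Parallel⇉Cyclic parallel-r cyclic))) j→r
        where
        cyclic = Q-→k'⇒Cyclic j→k'

      mutates-to-fork : ∀ {S} → r ∈ S → Acyclic Q (In Q S r) → Acyclic Q (Out Q S r) →
        (k ∈ S → k' ∈ S → ⊥) → ∃ (_∈ In Q S r) → i₀ ∈ S → MutatesToFork Q S r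
      mutates-to-fork r∈S acyclic-In acyclic-Out not-both in-vertex i₀∈S = record
        { isQuiver = isQ
        ; r∈S = r∈S
        ; abundant-at-r = λ x _ → AbundantOff⇒at Q-abundantOff other-r x
        ; abundant-In = AbundantOff⇒Abundant Q-abundantOff λ (k∈ , _) (k'∈ , _) → not-both k∈ k'∈
        ; abundant-Out = AbundantOff⇒Abundant Q-abundantOff λ (k∈ , _) (k'∈ , _) → not-both k∈ k'∈
        ; acyclic-In = acyclic-In
        ; acyclic-Out = acyclic-Out
        ; backward-bound = λ x y x∈ y∈ → backward-bound x y (proj₂ x∈) (proj₂ y∈)
        ; in-vertex = in-vertex
        ; out-vertex = i₀ , i₀∈S , r→i₀
        }

      F-fork-∖k : Fork (μ r Q) (AllV ∖ k) r
      F-fork-∖k = μ-fork (mutates-to-fork (tt , proj₁ other-r)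
        (Acyclic-source k'-source-in-In (Acyclic-⊆ (λ x∈ → tt , proj₂ x∈) Q-acyclic-∖k'))
        (Acyclic-⊆ (λ {x} (_ , r→x) → tt , λ { refl → r↛k' r→x }) Q-acyclic-∖k')
        (λ k∈ _ → proj₂ k∈ refl) (k' , (tt , k'≢k) , k'→r) (tt , proj₁ (Cyclic⇒Other cyclic-i₀)))

      F-fork-∖k' : Fork (μ r Q) (AllV ∖ k') r
      F-fork-∖k' = μ-fork (mutates-to-fork (tt , proj₂ other-r)
        (Acyclic-⊆ proj₁ Q-acyclic-∖k') (Acyclic-⊆ proj₁ Q-acyclic-∖k')
        (λ _ k'∈ → proj₂ k'∈ refl) (k , (tt , k≢k') , Q-k→ other-r) (tt , proj₂ (Cyclic⇒Other cyclic-i₀)))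

      F = μ r Q

      F-k→ : ∀ {i} → Other k k' i → r ≢ i → + 0 < F k i
      F-k→ {i} other-i r≢i = subst (+ 0 <_)
        (sym (μ-off-oneway r {Q} (proj₁ other-r) r≢i (λ _ r→k → Q-↛k other-r r→k)))
        (<-≤-trans (Q-k→ other-i) (x≤x+[]⁺*[]⁺ (Q k i) (Q k r) (Q r i)))

      F-k'→ : ∀ {i} → Other k k' i → r ≢ i → + 0 < F k' i
      F-k'→ {i} other-i r≢i = subst (+ 0 <_) (sym Fk'i≡) (by-class (classify other-i))
        where
        Fk'i≡ : F k' i ≡ Q k' i + [ Q k' r ]⁺ * [ Q r i ]⁺
        Fk'i≡ = μ-off-oneway r {Q} (proj₂ other-r) r≢i (λ _ r→k' → r↛k' r→k')
        by-class : Parallel i ⊎ Cyclic i → + 0 < Q k' i + [ Q k' r ]⁺ * [ Q r i ]⁺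
        by-class (inj₁ (_ , i→k')) =
          <-≤-trans (subst (+ 0 <_) (sym (Q-k'→ i)) i→k') (x≤x+[]⁺*[]⁺ (Q k' i) (Q k' r) (Q r i))
        by-class (inj₂ cyclic@(k'→i , _)) = subst (+ 0 <_) (sym through-r)
          (0<-b+d[c+db] (2≤⇒1≤ (W-2≤ (inj₂ other-i) k'→i))
                        (<⇒≤ (Parallel→Cyclic parallel-r cyclic))
                        (W-2≤ (inj₁ other-r) (proj₂ parallel-r)))
          where
          Qri≡ : Q r i ≡ w r i + w r k' * w k' i
          Qri≡ = μ-through k' isW (proj₂ parallel-r) k'→i
          r→i : + 0 < Q r i
          r→i = 2≤⇒0< (Q-⇉-Other other-r other-i (Parallel⇉Cyclic parallel-r cyclic))
          through-r : Q k' i + [ Q k' r ]⁺ * [ Q r i ]⁺ ≡ - w k' i + w r k' * (w r i + w r k' * w k' i)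
          through-r = cong₂ _+_ (μ-atˡ k' w i)
            (cong₂ _*_ (trans ([]⁺-pos k'→r) (Q-k'→ r)) (trans ([]⁺-pos r→i) Qri≡))

      orientation : ∀ i → i ≢ k → i ≢ k' → (+ 0 < F k i × + 0 < F k' i) ⊎ (+ 0 < F i k × + 0 < F i k')
      orientation i i≢k i≢k' with i ≟ r
      ... | yes refl = inj₂ (subst (+ 0 <_) (sym (μ-flipˡ i isQ k)) (Q-k→ other-r) ,
                             subst (+ 0 <_) (sym (μ-flipˡ i isQ k')) k'→r)
      ... | no i≢r = inj₁ (F-k→ (i≢k , i≢k') (i≢r ∘ sym) , F-k'→ (i≢k , i≢k') (i≢r ∘ sym))

    mutation-at-parallel : PreFork (μ r Q) r k k' × numArrows Q <ℕ numArrows (μ r Q)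
    mutation-at-parallel = (k≢k' , F-fork-∖k , F-fork-∖k' , orientation) ,
      numArrows-μ-< isQ r (AbundantOff⇒at Q-abundantOff other-r) backward-bound (Q-k→ other-r) r→i₀

  private
    grows-through-k' : ∀ {a b} → Parallel a → Cyclic b → ∣ w a b ∣ ≤ℕ ∣ Q a b ∣
    grows-through-k' {a} {b} parallel cyclic =
      subst (λ z → ∣ w a b ∣ ≤ℕ ∣ z ∣) (sym (μ-through k' isW (proj₂ parallel) (proj₁ cyclic)))
        (∣x∣≤∣x+y∣ (<⇒≤ (Parallel→Cyclic parallel cyclic))
                   (0≤* (<⇒≤ (proj₂ parallel)) (<⇒≤ (proj₁ cyclic))))

    -- Only the entries between k and a cyclic vertex can shrink under μ_{k'}.
    ∣W∣≤∣Q∣ : ∀ a b → a ≢ k → (b ≡ k → ¬ Cyclic a) → ∣ w a b ∣ ≤ℕ ∣ Q a b ∣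
    ∣W∣≤∣Q∣ a b a≢k not-k-cyclic = ∣∣≤∣μ∣ isW k' a b
      (λ a→k' k'→b → grows-through-k' (Parallel-by-→k' (a≢k , arrow⇒≢ isW a→k') a→k') (k'→⇒Cyclic k'→b))
      (λ b→k' k'→a → grows-through-k'
        (Parallel-by-→k' ((λ b≡k → not-k-cyclic b≡k (k'→⇒Cyclic k'→a)) , arrow⇒≢ isW b→k') b→k')
        (k'→⇒Cyclic k'→a))

    j₀ = proj₁ parallel-vertex
    parallel-j₀ = proj₂ parallel-vertex

    -- For a cyclic vertex a the entry (a, k) shrinks, but the growth of the entry (a, j₀) through k' outweighs it.
    row-< : ∀ {a} → Cyclic a → RowPlusColumn w k a <ℕ RowPlusColumn Q k a
    row-< {a} cyclic@(k'→a , a→k) = sum+at-< (proj₁ (Parallel⇒Other parallel-j₀))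
      (λ b b≢k _ → ∣W∣≤∣Q∣ a b a≢k (λ b≡k → ⊥-elim (b≢k b≡k))) at-k-and-j₀
      where
      a≢k = proj₁ (Cyclic⇒Other cyclic)
      j₀→a = Parallel→Cyclic parallel-j₀ cyclic
      Qj₀a≡ : Q j₀ a ≡ w j₀ a + w j₀ k' * w k' a
      Qj₀a≡ = μ-through k' isW (proj₂ parallel-j₀) k'→a
      0≤Qj₀a : + 0 ≤ Q j₀ a
      0≤Qj₀a = subst (+ 0 ≤_) (sym Qj₀a≡)
        (≤-trans (<⇒≤ j₀→a) (≤-by-gap _ refl (0≤* (<⇒≤ (proj₂ parallel-j₀)) (<⇒≤ k'→a))))
      in-ℤ : w a k + w a k + w j₀ a < Q k a + Q k a + Q j₀ a
      in-ℤ = subst₂ (λ u v → w a k + w a k + w j₀ a < u + u + v) (sym (Q-k-Cyclic cyclic)) (sym Qj₀a≡)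
        (2a+c<2[b-a]+c+db (<⇒≤ a→k) (<-≤-trans (x<x+2 (w a k)) (arrow-cond a a→k k'→a k→k'))
          (W-2≤ (inj₁ (Parallel⇒Other parallel-j₀)) (proj₂ parallel-j₀)))
      at-k-and-j₀ : ∣ w a k ∣ ℕ.+ ∣ w a k ∣ ℕ.+ ∣ w a j₀ ∣ <ℕ ∣ Q a k ∣ ℕ.+ ∣ Q a k ∣ ℕ.+ ∣ Q a j₀ ∣
      at-k-and-j₀ rewrite ∣∣-sym isW a j₀ | ∣∣-sym isQ a k | ∣∣-sym isQ a j₀ =
        2∣x∣+∣y∣<2∣x'∣+∣y'∣ (<⇒≤ a→k) (<⇒≤ j₀→a) (<⇒≤ (Q-k→ (Cyclic⇒Other cyclic))) 0≤Qj₀a in-ℤ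

  numArrows-W<Q : numArrows w <ℕ numArrows Q
  numArrows-W<Q = numArrows-<-by-rows isW isQ k row-≤ i₀ (proj₁ (Cyclic⇒Other cyclic-i₀)) (row-< cyclic-i₀)
    where
    i₀ = proj₁ cyclic-vertex
    cyclic-i₀ = proj₂ cyclic-vertex
    row-≤ : ∀ a → a ≢ k → RowPlusColumn w k a ≤ℕ RowPlusColumn Q k a
    row-≤ a a≢k with + 0 <? w k' a
    ... | yes k'→a = ℕₚ.<⇒≤ (row-< (k'→⇒Cyclic k'→a))
    ... | no k'↛a = ℕₚ.+-mono-≤ (sum-mono-≤ (λ b → ∣W∣≤∣Q∣ a b a≢k λ _ cyclic → k'↛a (proj₁ cyclic)))
                                (∣W∣≤∣Q∣ a k a≢k λ _ cyclic → k'↛a (proj₁ cyclic))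

  conclusion : Conclusion w k k'
  conclusion =
    (λ r r≢k r≢k' → W-μ-fork (r≢k , r≢k')) ,
    Q-fork-∖k ,
    (λ _ _ → Q-between≐In , Q-between-vertex) ,
    (λ Qkk'≡1 _ → ⊥-elim (-1≢1 (trans (sym Qkk'≡-1) Qkk'≡1))) ,
    Q-abundant-∖k' , Q-acyclic-∖k' ,
    (λ _ → Q-k-source) ,
    (λ Qkk'≡1 → ⊥-elim (-1≢1 (trans (sym Qkk'≡-1) Qkk'≡1))) ,
    numArrows-W<Q ,
    (λ r r∈B → mutation-at-cyclic (Q-→k'⇒Cyclic (proj₂ (proj₁ Q-between≐In r∈B)))) ,
    (λ r r∉B r≢k r≢k' → at-other r∉B (classify (r≢k , r≢k'))) ,
    Q-arrow-cond
    where
    at-other : ∀ {r} → r ∉ Between Q k k' → Parallel r ⊎ Cyclic r →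
      PreFork (μ r Q) r k k' × numArrows Q <ℕ numArrows (μ r Q)
    at-other _ (inj₁ parallel) = mutation-at-parallel parallel
    at-other {r} r∉B (inj₂ (k'→r , _)) =
      ⊥-elim (r∉B (proj₂ Q-between≐In (tt , subst (+ 0 <_) (sym (Q-→k' r)) k'→r)))

opposite : ∀ {n} → Mat n → Mat n
opposite q a b = q b a

∣x∣≡1⇒x≡±1 : ∀ x → ∣ x ∣ ≡ 1 → x ≡ + 1 ⊎ x ≡ -[1+ 0 ]
∣x∣≡1⇒x≡±1 (+ 1) _ = inj₁ refl
∣x∣≡1⇒x≡±1 -[1+ 0 ] _ = inj₂ refl

lemma4p17 : ∀ {n} (w : Mat n) (k k' : Fin n) → IsQuiver w → Wing w k k' → ∣ w k k' ∣ ≡ 1 →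
    (∀ r → r ≢ k → r ≢ k' → Fork (μ r w) AllV r)
    × Fork (μ k' w) (AllV ∖ k) k'
    × (μ k' w k' k ≡ + 1 → w k k' ≡ + 1 →
         (Between (μ k' w) k k' ≐ In (μ k' w) AllV k') × ∃ (λ i → i ∈ Between (μ k' w) k k'))
    × (μ k' w k k' ≡ + 1 → w k' k ≡ + 1 →
         (Between (μ k' w) k k' ≐ Out (μ k' w) AllV k') × ∃ (λ i → i ∈ Between (μ k' w) k k'))
    × Abundant (μ k' w) (AllV ∖ k') × Acyclic (μ k' w) (AllV ∖ k')
    × (μ k' w k' k ≡ + 1 → Source (μ k' w) (AllV ∖ k') k)
    × (μ k' w k k' ≡ + 1 → Sink (μ k' w) (AllV ∖ k') k)
    × numArrows w <ℕ numArrows (μ k' w)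
    × (∀ r → r ∈ Between (μ k' w) k k' →
         Fork (μ r (μ k' w)) AllV r × numArrows (μ k' w) <ℕ numArrows (μ r (μ k' w)))
    × (∀ r → r ∉ Between (μ k' w) k k' → r ≢ k → r ≢ k' →
         PreFork (μ r (μ k' w)) r k k' × numArrows (μ k' w) <ℕ numArrows (μ r (μ k' w)))
    × WingArrowCond (μ k' w) k k'
lemma4p17 w k k' isW wing ∣wkk'∣≡1 with ∣x∣≡1⇒x≡±1 (w k k') ∣wkk'∣≡1
... | inj₁ wkk'≡1 = PositiveWing.conclusion isW wing wkk'≡1
... | inj₂ wkk'≡-1 = Conclusion-op (IsOpposite-sym op)
        (PositiveWing.conclusion (λ a b → isW b a) (Wing-op op isW wing) (trans (isW k' k) (cong -_ wkk'≡-1)))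
  where
  op : IsOpposite w (opposite w)
  op _ _ = refl
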